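{- Let $G$ be a connected graph of order $n\ge 3$. (a) If $\dim_f(G)=\frac{n}{2}$, then $\mathrm{edim}_f(G)=\frac{n}{2}$. (b) There exists a connected graph $G$ of order $n\ge3$ satisfying $\mathrm{edim}_f(G)=\frac{n}{2}>\dim_f(G)$. Moreover, there exists a family of connected graphs $G$ with $\mathrm{edim}_f(G)=\frac{|V(G)|}{2}>\dim_f(G)$ such that $\frac{\mathrm{edim}_f(G)}{\dim_f(G)}$ can be arbitrarily large (i.e., for every real $M$ some member $G$ of the family has $\frac{\mathrm{edim}_f(G)}{\dim_f(G)}>M$).
   Context: All graphs are finite, simple, undirected; $d(u,w)$ is the length of a shortest $u$–$w$ path. For $g:V(G)\to\mathbb{R}$ and $U\subseteq V(G)$, $g(U)=\sum_{s\in U}g(s)$. For distinct vertices $x,y$, $R_v\{x,y\}=\{z\in V(G): d(x,z)\neq d(y,z)\}$; $g:V(G)\to[0,1]$ is a resolving function if $g(R_v\{x,y\})\ge1$ for all distinct vertices $x,y$, and $\dim_f(G)=\min\{g(V(G)): g\text{ a resolving function of }G\}$. For a vertex $v$ and an edge $e=xy$, $d(e,v)=\min\{d(x,v),d(y,v)\}$; for distinct edges $e_1,e_2$, $R_e\{e_1,e_2\}=\{v\in V(G): d(v,e_1)\neq d(v,e_2)\}$; $g:V(G)\to[0,1]$ is an edge resolving function if $g(R_e\{e_1,e_2\})\ge1$ for all distinct edges $e_1,e_2$, and $\mathrm{edim}_f(G)=\min\{g(V(G)): g\text{ an edge resolving function of }G\}$.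
   Formalization: Resolving and edge resolving functions take rational values in [0,1] rather than real ones, and the bound M in the unbounded-ratio claim ranges over the rationals. -}

module Defs where

open import Data.Nat using (ℕ; zero; suc)
open import Data.Bool using (Bool; true; false; _∧_; _∨_; if_then_else_)
open import Data.Fin using (Fin; _≟_)
open import Data.Fin.Properties using () renaming (_≟_ to _≟ᶠ_)
open import Data.List using (List; []; _∷_; allFin)
open import Data.Bool.ListAction using (any)
open import Data.Product using (Σ; _×_; _,_; ∃)
open import Data.Sum using (_⊎_)
open import Relation.Nullary using (¬_; Dec; does)
open import Relation.Binary.PropositionalEquality using (_≡_; _≢_)
open import Data.Rational using (ℚ; 0ℚ; 1ℚ; _+_; _≤_)
import Data.Nat as ℕ

record Graph (n : ℕ) : Set where
  field
    adj   : Fin n → Fin n → Bool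
    sym   : ∀ u v → adj u v ≡ adj v u
    irrefl : ∀ u → adj u u ≡ false
open Graph public

reach : ∀ {n} → Graph n → ℕ → Fin n → Fin n → Bool
reach G zero    u v = does (u ≟ v)
reach G (suc k) u v = reach G k u v ∨ any (λ w → reach G k u w ∧ adj G w v) (allFin _)

Connected : ∀ {n} → Graph n → Set
Connected {n} G = ∀ u v → ∃ λ k → reach G k u v ≡ true

-- least k with k₀ ≤ k ≤ k₀ + fuel and reach k; default value if none
private
  search : ∀ {n} → Graph n → Fin n → Fin n → ℕ → ℕ → ℕ
  search G u v k zero       = k
  search G u v k (suc fuel) = if reach G k u v then k else search G u v (suc k) fuel

-- Shortest-path distance d(u,v) (for connected graphs a shortest path
-- has length < n, so searching k = 0 … n suffices).
dist : ∀ {n} → Graph n → Fin n → Fin n → ℕ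
dist {n} G u v = search G u v 0 n

sumOver : ∀ {n} → (Fin n → Bool) → (Fin n → ℚ) → ℚ
sumOver {n} P g = go (allFin n)
  where
  go : List (Fin n) → ℚ
  go []       = 0ℚ
  go (z ∷ zs) = (if P z then g z else 0ℚ) + go zs

total : ∀ {n} → (Fin n → ℚ) → ℚ
total g = sumOver (λ _ → true) g

inRv : ∀ {n} → Graph n → Fin n → Fin n → Fin n → Bool
inRv G x y z = Data.Bool.not (does (dist G x z ℕ.≟ dist G y z))
  where import Data.Bool

Unit : ∀ {n} → (Fin n → ℚ) → Set
Unit g = ∀ z → (0ℚ ≤ g z) × (g z ≤ 1ℚ)

IsResolvingFunction : ∀ {n} → Graph n → (Fin n → ℚ) → Set
IsResolvingFunction G g =
  Unit g × (∀ x y → x ≢ y → 1ℚ ≤ sumOver (inRv G x y) g)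

IsFracDim : ∀ {n} → Graph n → ℚ → Set
IsFracDim G r =
  (Σ _ λ g → IsResolvingFunction G g × total g ≡ r) ×
  (∀ g → IsResolvingFunction G g → r ≤ total g)

-- edges: an edge is given by an ordered pair (a , b) with adj a b;
-- d(e,v) = min (d(a,v), d(b,v))
edgeDist : ∀ {n} → Graph n → Fin n → Fin n → Fin n → ℕ
edgeDist G a b v = dist G a v ℕ.⊓ dist G b v

inRe : ∀ {n} → Graph n → Fin n → Fin n → Fin n → Fin n → Fin n → Bool
inRe G a b c d v = Data.Bool.not (does (edgeDist G a b v ℕ.≟ edgeDist G c d v))
  where import Data.Bool

SameEdge : ∀ {n} → Fin n → Fin n → Fin n → Fin n → Set
SameEdge a b c d = (a ≡ c × b ≡ d) ⊎ (a ≡ d × b ≡ c)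

IsEdgeResolvingFunction : ∀ {n} → Graph n → (Fin n → ℚ) → Set
IsEdgeResolvingFunction G g =
  Unit g ×
  (∀ a b c d → adj G a b ≡ true → adj G c d ≡ true → ¬ SameEdge a b c d →
     1ℚ ≤ sumOver (inRe G a b c d) g)

IsFracEdgeDim : ∀ {n} → Graph n → ℚ → Set
IsFracEdgeDim G r =
  (Σ _ λ g → IsEdgeResolvingFunction G g × total g ≡ r) ×
  (∀ g → IsEdgeResolvingFunction G g → r ≤ total g)

half : ℕ → ℚ
half n = Data.Rational._/_ (Data.Integer.+_ n) 2
  where import Data.Rational; import Data.Integer

-- (a) If a vertex u had no twin (a vertex v with d(u,z) = d(v,z) for all z ≠ u, v), the function
-- that is ½ off u and 0 at u would be resolving, of weight (n − 1)/2; so dim_f(G) = n/2 forces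
-- every vertex to have a twin. In a connected graph of order ≥ 3 twins u, v have a common
-- neighbour x, and the edges ux, vx are distinguished only by u and v; hence every edge resolving
-- function puts weight ≥ 1 on every pair of twins, and since twins of a common vertex are twins,
-- its total weight is ≥ n/2. The constant ½ resolves every pair of edges.
--
-- (b) Join the k × k rook graph, k = 2t, with an edge (two apexes adjacent to everything). Any two
-- vertices x, y have a common neighbour h with d(x,z) ⊓ d(h,z) = d(y,z) ⊓ d(h,z) off {x, y},
-- so edim_f = n/2 = (k² + 2)/2 as in (a). The function ½ on the apexes and 1/(2k) on the cells
-- is resolving, and the apex pair together with t pairs of cells in one row, whose resolving sets
-- are disjoint, give dim_f = 1 + t. The ratio (k² + 2)/(k + 2) is unbounded.

module Submission where

open import Defs hiding (sym)
open import Data.Nat as ℕ using (ℕ; zero; suc; z≤n; s≤s; _⊓_)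
import Data.Nat.Properties as ℕ
import Data.Integer as ℤ
import Data.Integer.Properties as ℤ
import Data.Fin
open import Data.Fin using (Fin; zero; suc; _↑ˡ_; _↑ʳ_; combine; quotient; remainder; punchIn; punchOut)
open import Data.Fin.Properties
  using (_≟_; any?; all?; ¬∀⟶∃¬; remQuot-combine; combine-remQuot; suc-injective;
         punchInᵢ≢i; punchIn-injective; punchIn-punchOut; combine-injective; combine-injectiveʳ)
open import Data.Bool using (Bool; true; false; not; _∧_; _xor_; if_then_else_)
open import Data.Bool.ListAction using (any)
open import Data.List using (allFin; tabulate; foldr)
open import Data.List.Properties using (foldr-universal)
open import Data.List.Membership.Propositional.Properties using (∈-allFin)
import Data.List.Relation.Unary.Any as Any
open import Data.List.Relation.Unary.Any.Properties using (any⁺; any⁻)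
open import Data.List.Membership.Propositional using (_∈_)
open import Data.Bool.Properties using (T-≡; ∧-identityʳ; ∧-zeroʳ)
import Data.Bool as Bool
open import Function.Bundles using (Equivalence)
open import Data.Product as Product using (Σ; ∃; ∃₂; _×_; _,_; proj₁; proj₂)
open import Data.Sum using (_⊎_; inj₁; inj₂)
import Data.Sum
open import Data.Empty using (⊥)
open import Function using (_∘_; case_of_)
open import Relation.Nullary using (¬_; Dec; yes; no; does; contradiction)
open import Relation.Unary using (Decidable)
open import Relation.Nullary.Decidable using (dec-true; dec-false; _×-dec_; _⊎-dec_; _→-dec_; ¬?)
open import Relation.Binary.PropositionalEquality
open import Relation.Binary.Definitions using (DecidableEquality)
open import Data.Nat.Solver using (module +-*-Solver)
open import Data.Rational using (ℚ; 0ℚ; 1ℚ; ½; _+_; _*_; _≤_; _<_; toℚᵘ; fromℚᵘ; mkℚ)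
import Data.Rational as ℚ
import Data.Rational.Properties as ℚ
open import Data.Rational.Unnormalised as ℚᵘ using (mkℚᵘ; *≡*; *≤*)
import Data.Rational.Unnormalised.Properties as ℚᵘ
open import Algebra.Properties.CommutativeMonoid.Sum ℚ.+-0-commutativeMonoid
  using (sum; sum-syntax; ∑-distrib-+; ∑-comm; sum-cong-≗)

does-comm : ∀ {A : Set} (_≟ᴬ_ : DecidableEquality A) a b → does (a ≟ᴬ b) ≡ does (b ≟ᴬ a)
does-comm _≟ᴬ_ a b with a ≟ᴬ b
... | yes a≡b = sym (dec-true (b ≟ᴬ a) (sym a≡b))
... | no a≢b  = sym (dec-false (b ≟ᴬ a) (a≢b ∘ sym))

Nonneg : ∀ {n} → (Fin n → ℚ) → Set
Nonneg F = ∀ z → 0ℚ ≤ F z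

p≤p+q : ∀ {p q} → 0ℚ ≤ q → p ≤ p + q
p≤p+q {p} 0≤q = ℚ.≤-trans (ℚ.≤-reflexive (sym (ℚ.+-identityʳ p))) (ℚ.+-monoʳ-≤ p 0≤q)

restrict : ∀ {n} → (Fin n → Bool) → (Fin n → ℚ) → Fin n → ℚ
restrict P g z = if P z then g z else 0ℚ

erase : ∀ {n} → Fin n → (Fin n → ℚ) → Fin n → ℚ
erase u F z = if does (z ≟ u) then 0ℚ else F z

restrict-nonNeg : ∀ {n} (P : Fin n → Bool) {g} → Nonneg g → Nonneg (restrict P g)
restrict-nonNeg P g≥0 z with P z
... | true  = g≥0 z
... | false = ℚ.≤-refl

restrict-≤ : ∀ {n} (P : Fin n → Bool) {g} → Nonneg g → ∀ z → restrict P g z ≤ g z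
restrict-≤ P g≥0 z with P z
... | true  = ℚ.≤-refl
... | false = g≥0 z

restrict-member : ∀ {n} (P : Fin n → Bool) g {z} → P z ≡ true → restrict P g z ≡ g z
restrict-member P g Pz rewrite Pz = refl

restrict-nonmember : ∀ {n} (P : Fin n → Bool) g {z} → P z ≡ false → restrict P g z ≡ 0ℚ
restrict-nonmember P g Pz rewrite Pz = refl

erase-self : ∀ {n} (u : Fin n) F → erase u F u ≡ 0ℚ
erase-self u F rewrite dec-true (u ≟ u) refl = refl

erase-other : ∀ {n} (u : Fin n) F {z} → z ≢ u → erase u F z ≡ F z
erase-other u F {z} z≢u rewrite dec-false (z ≟ u) z≢u = refl

erase-nonNeg : ∀ {n} (u : Fin n) {F} → Nonneg F → Nonneg (erase u F)
erase-nonNeg u F≥0 z with does (z ≟ u)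
... | true  = ℚ.≤-refl
... | false = F≥0 z

foldr-tabulate≡sum : ∀ {m n} (F : Fin n → ℚ) (f : Fin m → Fin n) →
            foldr (λ z → F z +_) 0ℚ (tabulate f) ≡ sum (F ∘ f)
foldr-tabulate≡sum {zero}  F f = refl
foldr-tabulate≡sum {suc m} F f = cong (F (f zero) +_) (foldr-tabulate≡sum F (f ∘ suc))

-- sumOver folds over allFin n with a local function; foldr-universal identifies that fold
-- without naming it, the with-abstraction making its argument a variable.
sumOver≡sum : ∀ {n} (P : Fin n → Bool) g → sumOver P g ≡ sum (restrict P g)
sumOver≡sum {n} P g with allFin n in eq | foldr-universal _ (λ z → restrict P g z +_) 0ℚ refl (λ _ _ → refl)
... | zs | universal = trans (universal zs) (trans (cong (foldr _ 0ℚ) (sym eq)) (foldr-tabulate≡sum (restrict P g) (λ z → z)))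

total≡sum : ∀ {n} (g : Fin n → ℚ) → total g ≡ sum g
total≡sum g = sumOver≡sum (λ _ → true) g

sum-mono-≤ : ∀ {n} {F G : Fin n → ℚ} → (∀ z → F z ≤ G z) → sum F ≤ sum G
sum-mono-≤ {zero}  F≤G = ℚ.≤-refl
sum-mono-≤ {suc n} F≤G = ℚ.+-mono-≤ (F≤G zero) (sum-mono-≤ (F≤G ∘ suc))

sum-zero : ∀ {n} {F : Fin n → ℚ} → (∀ z → F z ≡ 0ℚ) → sum F ≡ 0ℚ
sum-zero {zero}  F≡0 = refl
sum-zero {suc n} F≡0 = cong₂ _+_ (F≡0 zero) (sum-zero (F≡0 ∘ suc))

sum-nonNeg : ∀ {n} {F : Fin n → ℚ} → Nonneg F → 0ℚ ≤ sum F
sum-nonNeg {n} F≥0 = ℚ.≤-trans (ℚ.≤-reflexive (sym (sum-zero {n} λ _ → refl))) (sum-mono-≤ F≥0)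

sum-erase : ∀ {n} (F : Fin n → ℚ) (u : Fin n) → sum F ≡ F u + sum (erase u F)
sum-erase {suc n} F zero = cong (F zero +_) (begin
    sum (F ∘ suc)                   ≡⟨ ℚ.+-identityˡ _ ⟨
    0ℚ + sum (F ∘ suc)              ≡⟨ cong (_+ sum (F ∘ suc)) (erase-self zero F) ⟨
    sum (erase zero F)              ∎)
  where open ≡-Reasoning
sum-erase {suc n} F (suc u) = begin
    F zero + sum (F ∘ suc)                          ≡⟨ cong (F zero +_) (sum-erase (F ∘ suc) u) ⟩
    F zero + (F (suc u) + sum (erase u (F ∘ suc)))  ≡⟨ ℚ.+-assoc (F zero) _ _ ⟨
    (F zero + F (suc u)) + sum (erase u (F ∘ suc))  ≡⟨ cong (_+ sum (erase u (F ∘ suc))) (ℚ.+-comm (F zero) _) ⟩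
    (F (suc u) + F zero) + sum (erase u (F ∘ suc))  ≡⟨ ℚ.+-assoc (F (suc u)) _ _ ⟩
    F (suc u) + sum (erase (suc u) F)               ∎
  where open ≡-Reasoning

sum-point : ∀ {n} (F : Fin n → ℚ) (u : Fin n) → (∀ z → z ≢ u → F z ≡ 0ℚ) → sum F ≡ F u
sum-point F u F≡0 = begin
    sum F                     ≡⟨ sum-erase F u ⟩
    F u + sum (erase u F)     ≡⟨ cong (F u +_) (sum-zero vanish) ⟩
    F u + 0ℚ                  ≡⟨ ℚ.+-identityʳ (F u) ⟩
    F u                       ∎
  where
  open ≡-Reasoning
  vanish : ∀ z → erase u F z ≡ 0ℚ
  vanish z with z ≟ u
  ... | yes _  = refl
  ... | no z≢u = F≡0 z z≢u

≤-sum : ∀ {n} {F : Fin n → ℚ} → Nonneg F → ∀ u → F u ≤ sum F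
≤-sum {F = F} F≥0 u = begin
    F u                        ≤⟨ p≤p+q (sum-nonNeg (erase-nonNeg u F≥0)) ⟩
    F u + sum (erase u F)      ≡⟨ sum-erase F u ⟨
    sum F                      ∎
  where open ℚ.≤-Reasoning

pair-≤-sum : ∀ {n} {F : Fin n → ℚ} → Nonneg F → ∀ {u v} → u ≢ v → F u + F v ≤ sum F
pair-≤-sum {F = F} F≥0 {u} {v} u≢v = begin
    F u + F v                   ≡⟨ cong (F u +_) (erase-other u F (u≢v ∘ sym)) ⟨
    F u + erase u F v           ≤⟨ ℚ.+-monoʳ-≤ (F u) (≤-sum (erase-nonNeg u F≥0) v) ⟩
    F u + sum (erase u F)       ≡⟨ sum-erase F u ⟨
    sum F                       ∎
  where open ℚ.≤-Reasoning

sum-≤-pair : ∀ {n} {F : Fin n → ℚ} → Nonneg F → ∀ u v →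
             (∀ z → z ≢ u → z ≢ v → F z ≡ 0ℚ) → sum F ≤ F u + F v
sum-≤-pair {F = F} F≥0 u v F≡0 = begin
    sum F                   ≡⟨ sum-erase F u ⟩
    F u + sum (erase u F)   ≡⟨ cong (F u +_) (sum-point (erase u F) v vanish) ⟩
    F u + erase u F v       ≤⟨ ℚ.+-monoʳ-≤ (F u) (erased≤ v) ⟩
    F u + F v               ∎
  where
  open ℚ.≤-Reasoning
  erased≤ : ∀ z → erase u F z ≤ F z
  erased≤ z with does (z ≟ u)
  ... | true  = F≥0 z
  ... | false = ℚ.≤-refl
  vanish : ∀ z → z ≢ v → erase u F z ≡ 0ℚ
  vanish z z≢v with z ≟ u
  ... | yes _  = refl
  ... | no z≢u = F≡0 z z≢u z≢v

sumOver-≥-pair : ∀ {n} (P : Fin n → Bool) {g} → Nonneg g → ∀ {p q} → p ≢ q →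
                 P p ≡ true → P q ≡ true → g p + g q ≤ sumOver P g
sumOver-≥-pair P {g} g≥0 {p} {q} p≢q Pp Pq = begin
    g p + g q                              ≡⟨ cong₂ _+_ (restrict-member P g Pp) (restrict-member P g Pq) ⟨
    restrict P g p + restrict P g q        ≤⟨ pair-≤-sum (restrict-nonNeg P g≥0) p≢q ⟩
    sum (restrict P g)                     ≡⟨ sumOver≡sum P g ⟨
    sumOver P g                            ∎
  where open ℚ.≤-Reasoning

sumOver-≤-pair : ∀ {n} (P : Fin n → Bool) {g} → Nonneg g → ∀ u v →
                 (∀ z → z ≢ u → z ≢ v → P z ≡ false) → sumOver P g ≤ g u + g v
sumOver-≤-pair P {g} g≥0 u v outside = begin
    sumOver P g                        ≡⟨ sumOver≡sum P g ⟩
    sum (restrict P g)                 ≤⟨ sum-≤-pair (restrict-nonNeg P g≥0) u v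
                                            (λ z z≢u z≢v → restrict-nonmember P g (outside z z≢u z≢v)) ⟩
    restrict P g u + restrict P g v    ≤⟨ ℚ.+-mono-≤ (restrict-≤ P g≥0 u) (restrict-≤ P g≥0 v) ⟩
    g u + g v                          ∎
  where open ℚ.≤-Reasoning

sumOver-cong : ∀ {n} {P Q : Fin n → Bool} → (∀ z → P z ≡ Q z) → ∀ g → sumOver P g ≡ sumOver Q g
sumOver-cong {P = P} {Q} P≗Q g = trans (sumOver≡sum P g)
  (trans (sum-cong-≗ (λ z → cong (if_then g z else 0ℚ) (P≗Q z))) (sym (sumOver≡sum Q g)))

sum-++ : ∀ m {l} (F : Fin (m ℕ.+ l) → ℚ) → sum F ≡ ∑[ i < m ] F (i ↑ˡ l) + ∑[ j < l ] F (m ↑ʳ j)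
sum-++ zero    F = sym (ℚ.+-identityˡ _)
sum-++ (suc m) F = trans (cong (F zero +_) (sum-++ m (F ∘ suc))) (sym (ℚ.+-assoc (F zero) _ _))

sum-combine : ∀ m {k} (F : Fin (m ℕ.* k) → ℚ) → sum F ≡ ∑[ i < m ] ∑[ j < k ] F (combine i j)
sum-combine zero    F = refl
sum-combine (suc m) {k} F =
  trans (sum-++ k F) (cong (∑[ j < k ] F (j ↑ˡ (m ℕ.* k)) +_) (sum-combine m (λ h → F (k ↑ʳ h))))

infixl 7 _/ₙ_
_/ₙ_ : ℕ → (d : ℕ) → .{{ℕ.NonZero d}} → ℚ
a /ₙ d = ℤ.+ a ℚ./ d

fromℚᵘ-homo-+ : ∀ p q → fromℚᵘ (p ℚᵘ.+ q) ≡ fromℚᵘ p + fromℚᵘ q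
fromℚᵘ-homo-+ p q = sym (begin
    fromℚᵘ p + fromℚᵘ q                  ≡⟨ ℚ.fromℚᵘ-toℚᵘ _ ⟨
    fromℚᵘ (toℚᵘ (fromℚᵘ p + fromℚᵘ q))  ≡⟨ ℚ.fromℚᵘ-cong (ℚᵘ.≃-trans (ℚ.toℚᵘ-homo-+ (fromℚᵘ p) (fromℚᵘ q))
                                              (ℚᵘ.+-cong (ℚ.toℚᵘ-fromℚᵘ p) (ℚ.toℚᵘ-fromℚᵘ q))) ⟩
    fromℚᵘ (p ℚᵘ.+ q)                    ∎)
  where open ≡-Reasoning

fromℚᵘ-homo-* : ∀ p q → fromℚᵘ (p ℚᵘ.* q) ≡ fromℚᵘ p * fromℚᵘ q
fromℚᵘ-homo-* p q = sym (begin
    fromℚᵘ p * fromℚᵘ q                  ≡⟨ ℚ.fromℚᵘ-toℚᵘ _ ⟨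
    fromℚᵘ (toℚᵘ (fromℚᵘ p * fromℚᵘ q))  ≡⟨ ℚ.fromℚᵘ-cong (ℚᵘ.≃-trans (ℚ.toℚᵘ-homo-* (fromℚᵘ p) (fromℚᵘ q))
                                              (ℚᵘ.*-cong (ℚ.toℚᵘ-fromℚᵘ p) (ℚ.toℚᵘ-fromℚᵘ q))) ⟩
    fromℚᵘ (p ℚᵘ.* q)                    ∎)
  where open ≡-Reasoning

/ₙ-cong : ∀ {a b} d e → a ℕ.* suc e ≡ b ℕ.* suc d → a /ₙ suc d ≡ b /ₙ suc e
/ₙ-cong {a} {b} d e eq = ℚ.fromℚᵘ-cong {mkℚᵘ (ℤ.+ a) d} {mkℚᵘ (ℤ.+ b) e} (*≡* (begin
    ℤ.+ a ℤ.* ℤ.+ suc e    ≡⟨ ℤ.pos-* a (suc e) ⟨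
    ℤ.+ (a ℕ.* suc e)      ≡⟨ cong ℤ.+_ eq ⟩
    ℤ.+ (b ℕ.* suc d)      ≡⟨ ℤ.pos-* b (suc d) ⟩
    ℤ.+ b ℤ.* ℤ.+ suc d    ∎))
  where open ≡-Reasoning

/ₙ-+ : ∀ a b d → a /ₙ suc d + b /ₙ suc d ≡ (a ℕ.+ b) /ₙ suc d
/ₙ-+ a b d = begin
    a /ₙ suc d + b /ₙ suc d                        ≡⟨ fromℚᵘ-homo-+ (mkℚᵘ (ℤ.+ a) d) (mkℚᵘ (ℤ.+ b) d) ⟨
    fromℚᵘ (mkℚᵘ (ℤ.+ a) d ℚᵘ.+ mkℚᵘ (ℤ.+ b) d)    ≡⟨ ℚ.fromℚᵘ-cong {mkℚᵘ (ℤ.+ a) d ℚᵘ.+ mkℚᵘ (ℤ.+ b) d} {mkℚᵘ (ℤ.+ (a ℕ.+ b)) d} (*≡* cross) ⟩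
    (a ℕ.+ b) /ₙ suc d                             ∎
  where
  open ≡-Reasoning
  D = ℤ.+ suc d
  cross : (ℤ.+ a ℤ.* D ℤ.+ ℤ.+ b ℤ.* D) ℤ.* D ≡ ℤ.+ (a ℕ.+ b) ℤ.* (D ℤ.* D)
  cross = begin
    (ℤ.+ a ℤ.* D ℤ.+ ℤ.+ b ℤ.* D) ℤ.* D    ≡⟨ cong (ℤ._* D) (ℤ.*-distribʳ-+ D (ℤ.+ a) (ℤ.+ b)) ⟨
    ((ℤ.+ a ℤ.+ ℤ.+ b) ℤ.* D) ℤ.* D        ≡⟨ ℤ.*-assoc (ℤ.+ a ℤ.+ ℤ.+ b) D D ⟩
    (ℤ.+ a ℤ.+ ℤ.+ b) ℤ.* (D ℤ.* D)        ≡⟨ cong (ℤ._* (D ℤ.* D)) (ℤ.pos-+ a b) ⟨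
    ℤ.+ (a ℕ.+ b) ℤ.* (D ℤ.* D)            ∎

/ₙ-* : ∀ a b d → (a /ₙ 1) * (b /ₙ suc d) ≡ (a ℕ.* b) /ₙ suc d
/ₙ-* a b d = begin
    (a /ₙ 1) * (b /ₙ suc d)                           ≡⟨ fromℚᵘ-homo-* (mkℚᵘ (ℤ.+ a) 0) (mkℚᵘ (ℤ.+ b) d) ⟨
    fromℚᵘ (mkℚᵘ (ℤ.+ a) 0 ℚᵘ.* mkℚᵘ (ℤ.+ b) d)   ≡⟨ ℚ.fromℚᵘ-cong {mkℚᵘ (ℤ.+ a) 0 ℚᵘ.* mkℚᵘ (ℤ.+ b) d} {mkℚᵘ (ℤ.+ (a ℕ.* b)) d} (*≡* cross) ⟩
    (a ℕ.* b) /ₙ suc d                            ∎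
  where
  open ≡-Reasoning
  D = ℤ.+ suc d
  cross : (ℤ.+ a ℤ.* ℤ.+ b) ℤ.* D ≡ ℤ.+ (a ℕ.* b) ℤ.* (ℤ.+ 1 ℤ.* D)
  cross = cong₂ ℤ._*_ (sym (ℤ.pos-* a b)) (sym (ℤ.*-identityˡ D))

/ₙ-nonNeg : ∀ a d → 0ℚ ≤ a /ₙ suc d
/ₙ-nonNeg a d = ℚ.nonNegative⁻¹ _ {{ℚ.normalize-nonNeg a (suc d)}}

/ₙ-pos : ∀ a d → 0ℚ < suc a /ₙ suc d
/ₙ-pos a d = ℚ.positive⁻¹ _ {{ℚ.normalize-pos (suc a) (suc d)}}

sum-const : ∀ k a d → ∑[ _ < k ] (a /ₙ suc d) ≡ (k ℕ.* a) /ₙ suc d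
sum-const zero    a d = sym (ℚ.0/n≡0 (suc d))
sum-const (suc k) a d = trans (cong (a /ₙ suc d +_) (sum-const k a d)) (/ₙ-+ a (k ℕ.* a) d)

sum-½ : ∀ n → ∑[ _ < n ] ½ ≡ half n
sum-½ n = trans (sum-const n 1 1) (cong (_/ₙ 2) (ℕ.*-identityʳ n))

/ₙ-mono-< : ∀ {a b} d → a ℕ.< b → a /ₙ suc d < b /ₙ suc d
/ₙ-mono-< {a} d a<b with ℕ.m≤n⇒∃[o]m+o≡n a<b
... | c , refl = begin-strict
    a /ₙ suc d                          ≡⟨ ℚ.+-identityʳ _ ⟨
    a /ₙ suc d + 0ℚ                     <⟨ ℚ.+-monoʳ-< (a /ₙ suc d) (/ₙ-pos c d) ⟩
    a /ₙ suc d + suc c /ₙ suc d         ≡⟨ /ₙ-+ a (suc c) d ⟩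
    (a ℕ.+ suc c) /ₙ suc d              ≡⟨ cong (_/ₙ suc d) (ℕ.+-suc a c) ⟩
    suc (a ℕ.+ c) /ₙ suc d              ∎
  where open ℚ.≤-Reasoning

≤-/ₙ1 : ∀ (p : ℚ) → ∃ λ m → p ≤ m /ₙ 1
≤-/ₙ1 p@(mkℚ i d-1 _) = ℤ.∣ i ∣ , ℚ.toℚᵘ-cancel-≤
  (ℚᵘ.≤-respʳ-≃ (ℚᵘ.≃-sym (ℚ.toℚᵘ-fromℚᵘ (mkℚᵘ (ℤ.+ ℤ.∣ i ∣) 0))) (*≤* (begin
    i ℤ.* ℤ.+ 1                ≡⟨ ℤ.*-identityʳ i ⟩
    i                          ≤⟨ i≤∣i∣ i ⟩
    ℤ.+ ℤ.∣ i ∣                ≤⟨ ℤ.+≤+ (ℕ.m≤m*n ℤ.∣ i ∣ (suc d-1)) ⟩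
    ℤ.+ (ℤ.∣ i ∣ ℕ.* suc d-1)  ≡⟨ ℤ.pos-* ℤ.∣ i ∣ (suc d-1) ⟩
    ℤ.+ ℤ.∣ i ∣ ℤ.* ℤ.+ suc d-1 ∎)))
  where
  open ℤ.≤-Reasoning
  i≤∣i∣ : ∀ i → i ℤ.≤ ℤ.+ ℤ.∣ i ∣
  i≤∣i∣ (ℤ.+ _)     = ℤ.≤-refl
  i≤∣i∣ ℤ.-[1+ _ ] = ℤ.-≤+

any⇒∃ : ∀ {A : Set} (p : A → Bool) xs → any p xs ≡ true → ∃ λ x → p x ≡ true
any⇒∃ p xs h = Product.map₂ (Equivalence.to T-≡) (Any.satisfied (any⁻ p xs (Equivalence.from T-≡ h)))

∈⇒any : ∀ {A : Set} (p : A → Bool) {x xs} → x ∈ xs → p x ≡ true → any p xs ≡ true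
∈⇒any p x∈xs px = Equivalence.to T-≡ (any⁺ p (Any.map (λ { refl → Equivalence.from T-≡ px }) x∈xs))

≢⇒2≤ : ∀ {n} {u v : Fin n} → u ≢ v → 2 ℕ.≤ n
≢⇒2≤ {suc zero}    {zero} {zero} u≢v = contradiction refl u≢v
≢⇒2≤ {suc (suc n)} u≢v = s≤s (s≤s z≤n)

module _ {n} (G : Graph n) where

  reach-0-refl : ∀ u → reach G 0 u u ≡ true
  reach-0-refl u = dec-true (u ≟ u) refl

  reach-0-≢ : ∀ {u v} → u ≢ v → reach G 0 u v ≡ false
  reach-0-≢ {u} {v} = dec-false (u ≟ v)

  reach-0⇒≡ : ∀ {u v} → reach G 0 u v ≡ true → u ≡ v
  reach-0⇒≡ {u} {v} h with u ≟ v
  ... | yes u≡v = u≡v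

  reach-suc : ∀ k u v → reach G k u v ≡ true → reach G (suc k) u v ≡ true
  reach-suc k u v h rewrite h = refl

  reach-step : ∀ k u w v → reach G k u w ≡ true → adj G w v ≡ true → reach G (suc k) u v ≡ true
  reach-step k u w v uw wv with reach G k u v
  ... | true  = refl
  ... | false = ∈⇒any (λ w → reach G k u w ∧ adj G w v) (∈-allFin w) (cong₂ _∧_ uw wv)

  reach-suc⁻ : ∀ k u v → reach G (suc k) u v ≡ true →
               reach G k u v ≡ true ⊎ ∃ λ w → reach G k u w ≡ true × adj G w v ≡ true
  reach-suc⁻ k u v h with reach G k u v
  ... | true  = inj₁ refl
  ... | false = inj₂ (Product.map₂ ∧-true⁻ (any⇒∃ _ (allFin n) h))
    where
    ∧-true⁻ : ∀ {a b} → a ∧ b ≡ true → a ≡ true × b ≡ true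
    ∧-true⁻ {true} {true} _ = refl , refl

  reach-prepend : ∀ k u w v → adj G u w ≡ true → reach G k w v ≡ true → reach G (suc k) u v ≡ true
  reach-prepend zero u w v uw wv with refl ← reach-0⇒≡ {w} {v} wv = reach-step 0 u u w (reach-0-refl u) uw
  reach-prepend (suc k) u w v uw wv with reach-suc⁻ k w v wv
  ... | inj₁ wv′            = reach-suc (suc k) u v (reach-prepend k u w v uw wv′)
  ... | inj₂ (y , wy , yv) = reach-step (suc k) u y v (reach-prepend k u w y uw wy) yv

  reach-sym : ∀ k u v → reach G k u v ≡ true → reach G k v u ≡ true
  reach-sym zero u v uv with refl ← reach-0⇒≡ {u} {v} uv = reach-0-refl u
  reach-sym (suc k) u v uv with reach-suc⁻ k u v uv
  ... | inj₁ uv′            = reach-suc k v u (reach-sym k u v uv′)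
  ... | inj₂ (w , uw , wv) = reach-prepend k v w u (trans (Graph.sym G v w) wv) (reach-sym k u w uw)

  reach-comm : ∀ k u v → reach G k u v ≡ reach G k v u
  reach-comm k u v with reach G k u v in uv | reach G k v u in vu
  ... | true  | true  = refl
  ... | false | false = refl
  ... | true  | false = trans (sym (reach-sym k u v uv)) vu
  ... | false | true  = trans (sym uv) (reach-sym k v u vu)

  reach-1⇒adj : ∀ {u v} → u ≢ v → reach G 1 u v ≡ true → adj G u v ≡ true
  reach-1⇒adj {u} {v} u≢v h with reach-suc⁻ 0 u v h
  ... | inj₁ uv = contradiction (reach-0⇒≡ uv) u≢v
  ... | inj₂ (w , uw , wv) with refl ← reach-0⇒≡ {u} {w} uw = wv

  adj⇒≢ : ∀ {u v} → adj G u v ≡ true → u ≢ v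
  adj⇒≢ {u} uv refl with trans (sym uv) (irrefl G u)
  ... | ()

  -- dist is defined with a private search; searchR is a copy we can reason about.
  searchR : Fin n → Fin n → ℕ → ℕ → ℕ
  searchR u v k zero    = k
  searchR u v k (suc f) = if reach G k u v then k else searchR u v (suc k) f

  searchR≡ : ∀ {u v k₀ k} f → k₀ ℕ.≤ k → k ℕ.≤ k₀ ℕ.+ f → reach G k u v ≡ true →
             (∀ j → j ℕ.< k → reach G j u v ≡ false) → searchR u v k₀ f ≡ k
  searchR≡ {k₀ = k₀} {k} zero k₀≤k k≤k₀ _ _ = ℕ.≤-antisym k₀≤k (subst (k ℕ.≤_) (ℕ.+-identityʳ k₀) k≤k₀)
  searchR≡ {u} {v} {k₀} {k} (suc f) k₀≤k k≤ hit below with ℕ.m≤n⇒m<n∨m≡n k₀≤k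
  ... | inj₂ refl rewrite hit = refl
  ... | inj₁ k₀<k rewrite below k₀ k₀<k = searchR≡ f k₀<k (subst (k ℕ.≤_) (ℕ.+-suc k₀ f) k≤) hit below

  searchR≥ : ∀ {u v k₀ k} f → k ℕ.≤ k₀ ℕ.+ f → (∀ j → j ℕ.< k → reach G j u v ≡ false) →
             k ℕ.≤ searchR u v k₀ f
  searchR≥ {k₀ = k₀} {k} zero k≤ _ = subst (k ℕ.≤_) (ℕ.+-identityʳ k₀) k≤
  searchR≥ {u} {v} {k₀} {k} (suc f) k≤ below with reach G k₀ u v in hit
  ... | true  = ℕ.≮⇒≥ (λ k₀<k → contradiction (trans (sym hit) (below k₀ k₀<k)) λ ())
  ... | false = searchR≥ f (subst (k ℕ.≤_) (ℕ.+-suc k₀ f) k≤) below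

  searchR-comm : ∀ u v k f → searchR u v k f ≡ searchR v u k f
  searchR-comm u v k zero = refl
  searchR-comm u v k (suc f) rewrite reach-comm k u v with reach G k v u
  ... | true  = refl
  ... | false = searchR-comm u v (suc k) f

SearchFunction : Set
SearchFunction = ∀ {n} → Graph n → Fin n → Fin n → ℕ → ℕ → ℕ

searchR-unique : (S : SearchFunction) → (∀ {n} (G : Graph n) u v k → S G u v k 0 ≡ k) →
  (∀ {n} (G : Graph n) u v k f → S G u v k (suc f) ≡ (if reach G k u v then k else S G u v (suc k) f)) →
  ∀ {n} (G : Graph n) u v k f → S G u v k f ≡ searchR G u v k f
searchR-unique S base step G u v k zero    = base G u v k
searchR-unique S base step G u v k (suc f) =
  trans (step G u v k f) (cong (if reach G k u v then k else_) (searchR-unique S base step G u v (suc k) f))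

-- S is solved by unification with the private search: packing the instance into q and
-- abstracting its components (fuel m separately from the size suc m) makes that a pattern problem.
dist≡searchR : ∀ {n} (G : Graph n) u v → dist G u v ≡ searchR G u v 0 n
dist≡searchR {suc m} G u v = atInstance (m , G , u , v)
  where
  atInstance : (q : Σ ℕ λ m → Graph (suc m) × Fin (suc m) × Fin (suc m)) →
               let (m , G , u , v) = q in dist G u v ≡ searchR G u v 0 (suc m)
  atInstance q with proj₁ q | ℕ.suc (proj₁ q) | proj₁ (proj₂ q) | proj₁ (proj₂ (proj₂ q)) | proj₂ (proj₂ (proj₂ q)) | 1
                  | searchR-unique _ (λ _ _ _ _ → refl) (λ _ _ _ _ _ → refl)
  ... | f | _ | G′ | u′ | v′ | k | unique = cong (if reach G′ 0 u′ v′ then 0 else_) (unique G′ u′ v′ k f)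

module _ {n} (G : Graph n) where

  dist≡ : ∀ {u v} k → k ℕ.≤ n → reach G k u v ≡ true → (∀ j → j ℕ.< k → reach G j u v ≡ false) →
          dist G u v ≡ k
  dist≡ {u} {v} k k≤n hit below = trans (dist≡searchR G u v) (searchR≡ G n z≤n k≤n hit below)

  dist≥ : ∀ {u v} k → k ℕ.≤ n → (∀ j → j ℕ.< k → reach G j u v ≡ false) → k ℕ.≤ dist G u v
  dist≥ {u} {v} k k≤n below = subst (k ℕ.≤_) (sym (dist≡searchR G u v)) (searchR≥ G n k≤n below)

  dist-comm : ∀ u v → dist G u v ≡ dist G v u
  dist-comm u v = begin
    dist G u v           ≡⟨ dist≡searchR G u v ⟩
    searchR G u v 0 n    ≡⟨ searchR-comm G u v 0 n ⟩
    searchR G v u 0 n    ≡⟨ dist≡searchR G v u ⟨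
    dist G v u           ∎
    where open ≡-Reasoning

  dist-self : ∀ u → dist G u u ≡ 0
  dist-self u = dist≡ 0 z≤n (reach-0-refl G u) λ _ ()

  dist-pos : ∀ {u v} → u ≢ v → 1 ℕ.≤ dist G u v
  dist-pos u≢v = dist≥ 1 (ℕ.≤-trans (s≤s z≤n) (≢⇒2≤ u≢v)) λ { zero _ → reach-0-≢ G u≢v ; (suc _) (s≤s ()) }

  adj⇒dist≡1 : ∀ {u v} → adj G u v ≡ true → dist G u v ≡ 1
  adj⇒dist≡1 {u} {v} uv = dist≡ 1 (ℕ.≤-trans (s≤s z≤n) (≢⇒2≤ u≢v))
    (reach-step G 0 u u v (reach-0-refl G u) uv) λ { zero _ → reach-0-≢ G u≢v ; (suc _) (s≤s ()) }
    where u≢v = adj⇒≢ G uv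

  not-adj⇒unreachable-<2 : ∀ {u v} → u ≢ v → adj G u v ≡ false → ∀ j → j ℕ.< 2 → reach G j u v ≡ false
  not-adj⇒unreachable-<2 u≢v ¬uv zero _ = reach-0-≢ G u≢v
  not-adj⇒unreachable-<2 {u} {v} u≢v ¬uv 1 _ with reach G 1 u v in uv
  ... | false = refl
  ... | true  = trans (sym (reach-1⇒adj G u≢v uv)) ¬uv
  not-adj⇒unreachable-<2 u≢v ¬uv (suc (suc _)) (s≤s (s≤s ()))

  dist≡1⇒adj : ∀ {u v} → dist G u v ≡ 1 → adj G u v ≡ true
  dist≡1⇒adj {u} {v} d≡1 with u ≟ v | adj G u v in uv
  ... | _        | true  = refl
  ... | yes refl | false = contradiction (trans (sym d≡1) (dist-self u)) λ ()
  ... | no u≢v   | false =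
    contradiction (subst (2 ℕ.≤_) d≡1 (dist≥ 2 (≢⇒2≤ u≢v) (not-adj⇒unreachable-<2 u≢v uv))) λ { (s≤s ()) }

third-vertex : ∀ {n} → 3 ℕ.≤ n → (u v : Fin n) → ∃ λ z → z ≢ u × z ≢ v
third-vertex (s≤s (s≤s (s≤s _))) u v with u ≟ v
... | yes refl = punchIn u zero , punchInᵢ≢i u zero , punchInᵢ≢i u zero
... | no u≢v   = punchIn u j , punchInᵢ≢i u j , j≢v
  where
  v′ = punchOut u≢v
  j  = punchIn v′ zero
  j≢v : punchIn u j ≢ v
  j≢v eq = punchInᵢ≢i v′ zero (punchIn-injective u j v′ (trans eq (sym (punchIn-punchOut u≢v))))

IsUniversal : ∀ {n} → Graph n → Fin n → Set
IsUniversal G c = ∀ z → z ≢ c → adj G c z ≡ true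

module _ {n} (G : Graph n) where

  walk-crosses : ∀ {P : Fin n → Set} → Decidable P → ∀ k a z → reach G k a z ≡ true → P a → ¬ P z →
                 ∃₂ λ w x → P w × ¬ P x × adj G w x ≡ true
  walk-crosses P? zero a z az Pa ¬Pz with refl ← reach-0⇒≡ G {a} {z} az = contradiction Pa ¬Pz
  walk-crosses P? (suc k) a z az Pa ¬Pz with reach-suc⁻ G k a z az
  ... | inj₁ az′ = walk-crosses P? k a z az′ Pa ¬Pz
  ... | inj₂ (y , ay , yz) with P? y
  ...   | yes Py = y , z , Py , ¬Pz , yz
  ...   | no ¬Py = walk-crosses P? k a y ay Pa ¬Py

  module _ {c} (universal : IsUniversal G c) where

    adj-universal : ∀ {z} → z ≢ c → adj G z c ≡ true
    adj-universal {z} z≢c = trans (Graph.sym G z c) (universal z z≢c)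

    reach-2-universal : ∀ u v → reach G 2 u v ≡ true
    reach-2-universal u v = by-cases (u ≟ v) (u ≟ c) (v ≟ c)
      where
      by-cases : Dec (u ≡ v) → Dec (u ≡ c) → Dec (v ≡ c) → reach G 2 u v ≡ true
      by-cases (yes refl) _ _ = reach-suc G 1 u u (reach-suc G 0 u u (reach-0-refl G u))
      by-cases (no u≢v) (yes refl) _ =
        reach-suc G 1 u v (reach-step G 0 u u v (reach-0-refl G u) (universal v (u≢v ∘ sym)))
      by-cases (no u≢v) (no _) (yes refl) =
        reach-suc G 1 u v (reach-step G 0 u u v (reach-0-refl G u) (adj-universal u≢v))
      by-cases (no _) (no u≢c) (no v≢c) =
        reach-step G 1 u c v (reach-step G 0 u u c (reach-0-refl G u) (adj-universal u≢c)) (universal v v≢c)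

    universal⇒connected : Connected G
    universal⇒connected u v = 2 , reach-2-universal u v

    dist-universal : ∀ {u v} → u ≢ v → adj G u v ≡ false → dist G u v ≡ 2
    dist-universal {u} {v} u≢v ¬uv =
      dist≡ G 2 (≢⇒2≤ u≢v) (reach-2-universal u v) (not-adj⇒unreachable-<2 G u≢v ¬uv)

SameEdge-sym : ∀ {n} {a b c d : Fin n} → SameEdge a b c d → SameEdge c d a b
SameEdge-sym (inj₁ (refl , refl)) = inj₁ (refl , refl)
SameEdge-sym (inj₂ (refl , refl)) = inj₂ (refl , refl)

module _ {n} (G : Graph n) where

  inRv-≢ : ∀ x y z → dist G x z ≢ dist G y z → inRv G x y z ≡ true
  inRv-≢ x y z ≢ = cong not (dec-false (dist G x z ℕ.≟ dist G y z) ≢)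

  inRv-≡ : ∀ x y z → dist G x z ≡ dist G y z → inRv G x y z ≡ false
  inRv-≡ x y z ≡ = cong not (dec-true (dist G x z ℕ.≟ dist G y z) ≡)

  inRv-comm : ∀ x y z → inRv G x y z ≡ inRv G y x z
  inRv-comm x y z = cong not (does-comm ℕ._≟_ (dist G x z) (dist G y z))

  inRv-left : ∀ {x y} → x ≢ y → inRv G x y x ≡ true
  inRv-left {x} {y} x≢y = inRv-≢ x y x λ eq → contradiction (trans (sym eq) (dist-self G x)) (ℕ.m<n⇒n≢0 (dist-pos G (x≢y ∘ sym)))

  inRv-right : ∀ {x y} → x ≢ y → inRv G x y y ≡ true
  inRv-right {x} {y} x≢y = trans (inRv-comm x y y) (inRv-left (x≢y ∘ sym))

  edgeDist-endpoint : ∀ {a b z} → z ≡ a ⊎ z ≡ b → edgeDist G a b z ≡ 0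
  edgeDist-endpoint {a} {b} (inj₁ refl) = cong (_⊓ dist G b a) (dist-self G a)
  edgeDist-endpoint {a} {b} (inj₂ refl) = trans (cong (dist G a b ⊓_) (dist-self G b)) (ℕ.⊓-zeroʳ (dist G a b))

  edgeDist-pos : ∀ {a b z} → z ≢ a → z ≢ b → 1 ℕ.≤ edgeDist G a b z
  edgeDist-pos z≢a z≢b = ℕ.⊓-glb (dist-pos G (z≢a ∘ sym)) (dist-pos G (z≢b ∘ sym))

  inRe-≡ : ∀ {a b c d z} → edgeDist G a b z ≡ edgeDist G c d z → inRe G a b c d z ≡ false
  inRe-≡ {a} {b} {c} {d} {z} ≡ = cong not (dec-true (edgeDist G a b z ℕ.≟ edgeDist G c d z) ≡)

  inRe-endpoint : ∀ {a b c d p} → p ≡ a ⊎ p ≡ b → p ≢ c → p ≢ d → inRe G a b c d p ≡ true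
  inRe-endpoint {a} {b} {c} {d} {p} p∈ab p≢c p≢d =
    cong not (dec-false (edgeDist G a b p ℕ.≟ edgeDist G c d p) λ eq →
      contradiction (trans (sym eq) (edgeDist-endpoint p∈ab)) (ℕ.m<n⇒n≢0 (edgeDist-pos p≢c p≢d)))

  inRe-comm : ∀ a b c d z → inRe G a b c d z ≡ inRe G c d a b z
  inRe-comm a b c d z = cong not (does-comm ℕ._≟_ (edgeDist G a b z) (edgeDist G c d z))

  endpoint-outside : ∀ {a b c d} → adj G a b ≡ true → adj G c d ≡ true → ¬ SameEdge a b c d →
                     ∃ λ p → (p ≡ a ⊎ p ≡ b) × p ≢ c × p ≢ d
  endpoint-outside {a} {b} {c} {d} ab cd ¬same with a ≟ c | a ≟ d | b ≟ c | b ≟ d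
  ... | no a≢c | no a≢d | _ | _ = a , inj₁ refl , a≢c , a≢d
  ... | _ | _ | no b≢c | no b≢d = b , inj₂ refl , b≢c , b≢d
  ... | yes refl | _ | yes refl | _ = contradiction refl (adj⇒≢ G ab)
  ... | yes refl | _ | no _ | yes refl = contradiction (inj₁ (refl , refl)) ¬same
  ... | no _ | yes refl | yes refl | _ = contradiction (inj₂ (refl , refl)) ¬same
  ... | no _ | yes refl | no _ | yes refl = contradiction refl (adj⇒≢ G ab)

  ½-edgeResolving : IsEdgeResolvingFunction G (λ _ → ½)
  ½-edgeResolving = (λ _ → ℚ.≤ᵇ⇒≤ _ , ℚ.≤ᵇ⇒≤ _) , resolves
    where
    resolves : ∀ a b c d → adj G a b ≡ true → adj G c d ≡ true → ¬ SameEdge a b c d →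
               1ℚ ≤ sumOver (inRe G a b c d) (λ _ → ½)
    resolves a b c d ab cd ¬same with endpoint-outside ab cd ¬same | endpoint-outside cd ab (¬same ∘ SameEdge-sym)
    ... | p , p∈ab , p≢c , p≢d | q , q∈cd , q≢a , q≢b =
      sumOver-≥-pair (inRe G a b c d) (λ _ → ℚ.≤ᵇ⇒≤ _) p≢q
        (inRe-endpoint p∈ab p≢c p≢d) (trans (inRe-comm a b c d q) (inRe-endpoint q∈cd q≢a q≢b))
      where
      p≢q : p ≢ q
      p≢q refl = Data.Sum.[ q≢a , q≢b ]′ p∈ab

  edge-pair-bound : ∀ {g} → IsEdgeResolvingFunction G g → ∀ {u v x} → u ≢ v →
                    adj G u x ≡ true → adj G v x ≡ true →
                    (∀ z → z ≢ u → z ≢ v → edgeDist G u x z ≡ edgeDist G v x z) → 1ℚ ≤ g u + g v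
  edge-pair-bound {g} (unit , resolves) {u} {v} {x} u≢v ux vx same-elsewhere = begin
      1ℚ                          ≤⟨ resolves u x v x ux vx ¬same ⟩
      sumOver (inRe G u x v x) g  ≤⟨ sumOver-≤-pair (inRe G u x v x) (proj₁ ∘ unit) u v
                                       (λ z z≢u z≢v → inRe-≡ (same-elsewhere z z≢u z≢v)) ⟩
      g u + g v                   ∎
    where
    open ℚ.≤-Reasoning
    ¬same : ¬ SameEdge u x v x
    ¬same (inj₁ (u≡v , _)) = u≢v u≡v
    ¬same (inj₂ (u≡x , _)) = adj⇒≢ G ux u≡x

_∖_ : ∀ {n} → (Fin n → Bool) → Fin n → Fin n → Bool
(S ∖ u) z = S z ∧ not (does (z ≟ u))

size : ∀ {n} → (Fin n → Bool) → ℕ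
size {zero}  S = 0
size {suc n} S = (if S zero then 1 else 0) ℕ.+ size (S ∘ suc)

size-cong : ∀ {n} {S S′ : Fin n → Bool} → (∀ z → S z ≡ S′ z) → size S ≡ size S′
size-cong {zero}  _  = refl
size-cong {suc n} eq = cong₂ ℕ._+_ (cong (if_then 1 else 0) (eq zero)) (size-cong (eq ∘ suc))

size-∖ : ∀ {n} (S : Fin n → Bool) {u} → S u ≡ true → size S ≡ suc (size (S ∖ u))
size-∖ {suc n} S {zero} Su rewrite Su = cong suc (size-cong λ z → sym (∧-identityʳ (S (suc z))))
size-∖ {suc n} S {suc u} Su rewrite size-∖ (S ∘ suc) Su | ∧-identityʳ (S zero) = ℕ.+-suc _ _

∖-member : ∀ {n} (S : Fin n → Bool) {u z} → S z ≡ true → z ≢ u → (S ∖ u) z ≡ true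
∖-member S {u} {z} Sz z≢u rewrite Sz = cong not (dec-false (z ≟ u) z≢u)

∖-member⁻ : ∀ {n} (S : Fin n → Bool) {u z} → (S ∖ u) z ≡ true → S z ≡ true × z ≢ u
∖-member⁻ S {u} {z} h with S z | z ≟ u
... | true | no z≢u = refl , z≢u

sum-restrict-∖ : ∀ {n} (S : Fin n → Bool) F {u} → S u ≡ true →
                 sum (restrict S F) ≡ F u + sum (restrict (S ∖ u) F)
sum-restrict-∖ S F {u} Su = begin
    sum (restrict S F)                       ≡⟨ sum-erase (restrict S F) u ⟩
    restrict S F u + sum (erase u (restrict S F))  ≡⟨ cong₂ _+_ (restrict-member S F Su) (sum-cong-≗ erased) ⟩
    F u + sum (restrict (S ∖ u) F)           ∎
  where
  open ≡-Reasoning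
  erased : ∀ z → erase u (restrict S F) z ≡ restrict (S ∖ u) F z
  erased z with z ≟ u
  ... | yes _ rewrite ∧-zeroʳ (S z)     = refl
  ... | no _  rewrite ∧-identityʳ (S z) = refl

-- A vertex of weight < ½ is removed together with a partner; no other light vertex can have that
-- partner, since partners of a common vertex are partners and two light vertices weigh < 1.
module Pairing {n} (g : Fin n → ℚ) (g≥0 : Nonneg g) (T : Fin n → Fin n → Set)
  (T⇒1≤ : ∀ {u v} → T u v → 1ℚ ≤ g u + g v)
  (T-euclidean : ∀ {u v w} → T u w → T v w → u ≢ v → T u v) where

  ¬light-partners : ∀ {u v} → T u v → g u < ½ → g v < ½ → ⊥
  ¬light-partners uv gu<½ gv<½ = ℚ.<-irrefl refl (ℚ.≤-<-trans (T⇒1≤ uv) (ℚ.+-mono-< gu<½ gv<½))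

  LightPartnered : (Fin n → Bool) → Set
  LightPartnered S = ∀ w → S w ≡ true → g w < ½ → ∃ λ v → S v ≡ true × T w v

  ½-≤-on : ∀ fuel S → size S ℕ.≤ fuel → LightPartnered S →
           sum (restrict S (λ _ → ½)) ≤ sum (restrict S g)
  ½-≤-on fuel S size≤ partnered with any? (λ w → (S w Bool.≟ true) ×-dec (g w ℚ.<? ½))
  ... | no ¬light = sum-mono-≤ heavy
    where
    heavy : ∀ z → restrict S (λ _ → ½) z ≤ restrict S g z
    heavy z with S z in Sz
    ... | false = ℚ.≤-refl
    ... | true  = ℚ.≮⇒≥ (λ gz<½ → ¬light (z , Sz , gz<½))
  ... | yes (w , Sw , gw<½) with partnered w Sw gw<½
  ...   | v , Sv , wv = pair-off fuel size≤
    where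
    w≢v : w ≢ v
    w≢v refl = ¬light-partners wv gw<½ gw<½
    S′  = S ∖ w
    S′v : S′ v ≡ true
    S′v = ∖-member S Sv (w≢v ∘ sym)
    S″  = S′ ∖ v
    split : ∀ F → sum (restrict S F) ≡ F w + (F v + sum (restrict S″ F))
    split F = trans (sum-restrict-∖ S F Sw) (cong (F w +_) (sum-restrict-∖ S′ F S′v))
    partnered″ : LightPartnered S″
    partnered″ z S″z gz<½ with ∖-member⁻ S′ S″z
    ... | S′z , z≢v with ∖-member⁻ S S′z
    ...   | Sz , z≢w with partnered z Sz gz<½
    ...     | v′ , Sv′ , zv′ = v′ , ∖-member S′ (∖-member S Sv′ v′≢w) v′≢v , zv′
      where
      v′≢w : v′ ≢ w
      v′≢w refl = ¬light-partners zv′ gz<½ gw<½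
      v′≢v : v′ ≢ v
      v′≢v refl = ¬light-partners (T-euclidean zv′ wv z≢w) gz<½ gw<½
    size≡ : size S ≡ 2 ℕ.+ size S″
    size≡ = trans (size-∖ S Sw) (cong suc (size-∖ S′ S′v))
    pair-off : ∀ fuel → size S ℕ.≤ fuel → sum (restrict S (λ _ → ½)) ≤ sum (restrict S g)
    pair-off zero size≤ = contradiction (subst (ℕ._≤ 0) size≡ size≤) λ ()
    pair-off (suc fuel) size≤ = begin
        sum (restrict S (λ _ → ½))                ≡⟨ split (λ _ → ½) ⟩
        ½ + (½ + sum (restrict S″ (λ _ → ½)))     ≡⟨ ℚ.+-assoc ½ ½ (sum (restrict S″ (λ _ → ½))) ⟨
        1ℚ + sum (restrict S″ (λ _ → ½))          ≤⟨ ℚ.+-mono-≤ (T⇒1≤ wv) (½-≤-on fuel S″ size″≤ partnered″) ⟩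
        (g w + g v) + sum (restrict S″ g)         ≡⟨ ℚ.+-assoc (g w) (g v) (sum (restrict S″ g)) ⟩
        g w + (g v + sum (restrict S″ g))         ≡⟨ split g ⟨
        sum (restrict S g)                        ∎
      where
      open ℚ.≤-Reasoning
      size″≤ : size S″ ℕ.≤ fuel
      size″≤ = ℕ.≤-pred (ℕ.≤-trans (ℕ.n≤1+n _) (subst (ℕ._≤ suc fuel) size≡ size≤))

  half≤sum : (∀ u → ∃ (T u)) → half n ≤ sum g
  half≤sum partner = begin
      half n                      ≡⟨ sum-½ n ⟨
      ∑[ _ < n ] ½                ≤⟨ ½-≤-on n (λ _ → true) (size-all n) (λ w _ _ → Product.map₂ (refl ,_) (partner w)) ⟩
      sum g                       ∎
    where
    open ℚ.≤-Reasoning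
    size-all : ∀ k → size {k} (λ _ → true) ℕ.≤ k
    size-all zero    = z≤n
    size-all (suc k) = s≤s (size-all k)

module _ {n} (G : Graph n) where

  SameDistancesAt : Fin n → Fin n → Fin n → Set
  SameDistancesAt u v z = z ≢ u → z ≢ v → dist G u z ≡ dist G v z

  Twin : Fin n → Fin n → Set
  Twin u v = u ≢ v × (∀ z → SameDistancesAt u v z)

  sameDistancesAt? : ∀ u v z → Dec (SameDistancesAt u v z)
  sameDistancesAt? u v z = ¬? (z ≟ u) →-dec (¬? (z ≟ v) →-dec (dist G u z ℕ.≟ dist G v z))

  twin? : ∀ u v → Dec (Twin u v)
  twin? u v = ¬? (u ≟ v) ×-dec all? (sameDistancesAt? u v)

  twin-euclidean : ∀ {u v w} → Twin u w → Twin v w → u ≢ v → Twin u v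
  twin-euclidean {u} {v} {w} (u≢w , uw) (v≢w , vw) u≢v = u≢v , same
    where
    same : ∀ z → z ≢ u → z ≢ v → dist G u z ≡ dist G v z
    same z z≢u z≢v with z ≟ w
    ... | no z≢w   = trans (uw z z≢u z≢w) (sym (vw z z≢v z≢w))
    ... | yes refl = begin
        dist G u z   ≡⟨ dist-comm G u z ⟩
        dist G z u   ≡⟨ vw u u≢v u≢w ⟨
        dist G v u   ≡⟨ dist-comm G v u ⟩
        dist G u v   ≡⟨ uw v (u≢v ∘ sym) v≢w ⟩
        dist G z v   ≡⟨ dist-comm G z v ⟩
        dist G v z   ∎
      where open ≡-Reasoning

  distinguishing-vertex : ∀ {u v} → u ≢ v → ¬ Twin u v →
                          ∃ λ z → z ≢ u × z ≢ v × dist G u z ≢ dist G v z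
  distinguishing-vertex {u} {v} u≢v ¬twin with ¬∀⟶∃¬ n _ (sameDistancesAt? u v) (λ same → ¬twin (u≢v , same))
  ... | z , ¬same = z , (λ { refl → ¬same λ z≢u _ → contradiction refl z≢u })
                  , (λ { refl → ¬same λ _ z≢v → contradiction refl z≢v })
                  , (λ eq → ¬same λ _ _ → eq)

  ½-except : Fin n → Fin n → ℚ
  ½-except u = erase u (λ _ → ½)

  ½-except-unit : ∀ u → Unit (½-except u)
  ½-except-unit u z with does (z ≟ u)
  ... | true  = ℚ.≤-refl , ℚ.≤ᵇ⇒≤ _
  ... | false = ℚ.≤ᵇ⇒≤ _ , ℚ.≤ᵇ⇒≤ _

  ½-except-pair : ∀ u (P : Fin n → Bool) {p q} → p ≢ q → p ≢ u → q ≢ u → P p ≡ true → P q ≡ true →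
                  1ℚ ≤ sumOver P (½-except u)
  ½-except-pair u P {p} {q} p≢q p≢u q≢u Pp Pq = begin
      1ℚ                                ≡⟨ cong₂ _+_ (erase-other u _ p≢u) (erase-other u _ q≢u) ⟨
      ½-except u p + ½-except u q       ≤⟨ sumOver-≥-pair P (proj₁ ∘ ½-except-unit u) p≢q Pp Pq ⟩
      sumOver P (½-except u)            ∎
    where open ℚ.≤-Reasoning

  ½-except-resolving : ∀ u → (∀ v → ¬ Twin u v) → IsResolvingFunction G (½-except u)
  ½-except-resolving u no-twin = ½-except-unit u , resolves
    where
    resolves : ∀ x y → x ≢ y → 1ℚ ≤ sumOver (inRv G x y) (½-except u)
    resolves x y x≢y with x ≟ u | y ≟ u
    ... | yes refl | yes refl = contradiction refl x≢y
    ... | no x≢u | no y≢u = ½-except-pair u (inRv G x y) x≢y x≢u y≢u (inRv-left G x≢y) (inRv-right G x≢y)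
    ... | yes refl | no y≢u with distinguishing-vertex x≢y (no-twin y)
    ...   | z , z≢x , z≢y , xz≢yz =
      ½-except-pair u (inRv G x y) (z≢y ∘ sym) y≢u z≢x (inRv-right G x≢y) (inRv-≢ G x y z xz≢yz)
    resolves x y x≢y | no x≢u | yes refl with distinguishing-vertex (x≢y ∘ sym) (no-twin x)
    ...   | z , z≢y , z≢x , yz≢xz =
      ½-except-pair u (inRv G x y) (z≢x ∘ sym) x≢u z≢y (inRv-left G x≢y) (inRv-≢ G x y z (yz≢xz ∘ sym))

  half≡½+total-½-except : ∀ u → half n ≡ ½ + total (½-except u)
  half≡½+total-½-except u = begin
      half n                       ≡⟨ sum-½ n ⟨
      ∑[ _ < n ] ½                 ≡⟨ sum-erase (λ _ → ½) u ⟩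
      ½ + sum (½-except u)         ≡⟨ cong (½ +_) (total≡sum (½-except u)) ⟨
      ½ + total (½-except u)       ∎
    where open ≡-Reasoning

  every-vertex-has-twin : IsFracDim G (half n) → ∀ u → ∃ (Twin u)
  every-vertex-has-twin (_ , minimal) u with any? (twin? u)
  ... | yes twin = twin
  ... | no ¬twin = contradiction (minimal (½-except u) (½-except-resolving u λ v t → ¬twin (v , t))) too-small
    where
    too-small : ¬ half n ≤ total (½-except u)
    too-small h = ℚ.<-irrefl refl (begin-strict
      total (½-except u)        ≡⟨ ℚ.+-identityˡ _ ⟨
      0ℚ + total (½-except u)   <⟨ ℚ.+-monoˡ-< (total (½-except u)) (ℚ.positive⁻¹ ½) ⟩
      ½ + total (½-except u)    ≡⟨ half≡½+total-½-except u ⟨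
      half n                    ≤⟨ h ⟩
      total (½-except u)        ∎)
      where open ℚ.≤-Reasoning

  -- A walk from u to a third vertex leaves {u, v} along an edge wx; x is at distance 1 from
  -- u or v, hence from both.
  twins-common-neighbour : 3 ℕ.≤ n → Connected G → ∀ {u v} → Twin u v →
                           ∃ λ x → adj G u x ≡ true × adj G v x ≡ true
  twins-common-neighbour 3≤n connected {u} {v} (u≢v , same) with third-vertex 3≤n u v
  ... | z , z≢u , z≢v with connected u z
  ...   | k , uz with walk-crosses G {λ x → x ≡ u ⊎ x ≡ v} (λ x → (x ≟ u) ⊎-dec (x ≟ v)) k u z uz
                       (inj₁ refl) Data.Sum.[ z≢u , z≢v ]′
  ...     | w , x , w∈uv , x∉uv , wx = x , both w∈uv
    where
    x≢u = x∉uv ∘ inj₁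
    x≢v = x∉uv ∘ inj₂
    both : w ≡ u ⊎ w ≡ v → adj G u x ≡ true × adj G v x ≡ true
    both (inj₁ refl) = wx , dist≡1⇒adj G (trans (sym (same x x≢u x≢v)) (adj⇒dist≡1 G wx))
    both (inj₂ refl) = dist≡1⇒adj G (trans (same x x≢u x≢v) (adj⇒dist≡1 G wx)) , wx

  twin-weight : 3 ℕ.≤ n → Connected G → ∀ {g} → IsEdgeResolvingFunction G g →
                ∀ {u v} → Twin u v → 1ℚ ≤ g u + g v
  twin-weight 3≤n connected resolving twin@(u≢v , same) with twins-common-neighbour 3≤n connected twin
  ... | x , ux , vx = edge-pair-bound G resolving u≢v ux vx λ z z≢u z≢v → cong (_⊓ dist G x z) (same z z≢u z≢v)

fracEdgeDim-½ : ∀ {n} (G : Graph n) → (∀ g → IsEdgeResolvingFunction G g → half n ≤ total g) →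
                IsFracEdgeDim G (half n)
fracEdgeDim-½ {n} G minimal = ((λ _ → ½) , ½-edgeResolving G , trans (total≡sum {n} (λ _ → ½)) (sum-½ n)) , minimal

fracDim-half⇒fracEdgeDim-half : ∀ {n} → 3 ℕ.≤ n → (G : Graph n) → Connected G →
                                IsFracDim G (half n) → IsFracEdgeDim G (half n)
fracDim-half⇒fracEdgeDim-half {n} 3≤n G connected fracDim = fracEdgeDim-½ G minimal
  where
  minimal : ∀ g → IsEdgeResolvingFunction G g → half n ≤ total g
  minimal g resolving = subst (half n ≤_) (sym (total≡sum g))
    (Pairing.half≤sum g (proj₁ ∘ proj₁ resolving) (Twin G) (twin-weight G 3≤n connected resolving)
      (twin-euclidean G) (every-vertex-has-twin G fracDim))

module _ {n} (G : Graph n) {g} (resolving : IsEdgeResolvingFunction G g) where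

  edgeDist-universal : ∀ {h} → IsUniversal G h → ∀ {x z} → z ≢ x → edgeDist G x h z ≡ dist G h z
  edgeDist-universal {h} universal {x} {z} z≢x with z ≟ h
  ... | yes refl = begin
      dist G x z ⊓ dist G z z   ≡⟨ cong (dist G x z ⊓_) (dist-self G z) ⟩
      dist G x z ⊓ 0            ≡⟨ ℕ.⊓-zeroʳ (dist G x z) ⟩
      0                         ≡⟨ dist-self G z ⟨
      dist G z z                ∎
    where open ≡-Reasoning
  ... | no z≢h = begin
      dist G x z ⊓ dist G h z   ≡⟨ cong (dist G x z ⊓_) h-z ⟩
      dist G x z ⊓ 1            ≡⟨ ℕ.m≥n⇒m⊓n≡n (dist-pos G (z≢x ∘ sym)) ⟩
      1                         ≡⟨ h-z ⟨
      dist G h z                ∎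
    where
    open ≡-Reasoning
    h-z = adj⇒dist≡1 G (universal z z≢h)

  weight-via-universal : ∀ {h} → IsUniversal G h → ∀ {x y} → x ≢ y → x ≢ h → y ≢ h → 1ℚ ≤ g x + g y
  weight-via-universal universal x≢y x≢h y≢h =
    edge-pair-bound G resolving x≢y (adj-universal G universal x≢h) (adj-universal G universal y≢h)
      λ z z≢x z≢y → trans (edgeDist-universal universal z≢x) (sym (edgeDist-universal universal z≢y))

  weight-of-universals : 3 ℕ.≤ n → ∀ {x y} → IsUniversal G x → IsUniversal G y → x ≢ y → 1ℚ ≤ g x + g y
  weight-of-universals 3≤n {x} {y} universal-x universal-y x≢y with third-vertex 3≤n x y
  ... | w , w≢x , w≢y = edge-pair-bound G resolving x≢y (universal-x w w≢x) (universal-y w w≢y)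
        λ z z≢x z≢y → cong (_⊓ dist G w z)
          (trans (adj⇒dist≡1 G (universal-x z z≢x)) (sym (adj⇒dist≡1 G (universal-y z z≢y))))

  weight-two-universals : 3 ℕ.≤ n → ∀ {c₀ c₁} → c₀ ≢ c₁ → IsUniversal G c₀ → IsUniversal G c₁ →
                          ∀ {x y} → x ≢ y → 1ℚ ≤ g x + g y
  weight-two-universals 3≤n {c₀} {c₁} c₀≢c₁ u₀ u₁ {x} {y} x≢y with x ≟ c₀ | y ≟ c₀ | x ≟ c₁ | y ≟ c₁
  ... | no x≢c₀  | no y≢c₀  | _        | _        = weight-via-universal u₀ x≢y x≢c₀ y≢c₀
  ... | _        | _        | no x≢c₁  | no y≢c₁  = weight-via-universal u₁ x≢y x≢c₁ y≢c₁
  ... | yes refl | _        | yes refl | _        = contradiction refl c₀≢c₁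
  ... | _        | yes refl | _        | yes refl = contradiction refl c₀≢c₁
  ... | yes refl | _        | no _     | yes refl = weight-of-universals 3≤n u₀ u₁ x≢y
  ... | no _     | yes refl | yes refl | _        = weight-of-universals 3≤n u₁ u₀ x≢y

two-universals⇒fracEdgeDim-half : ∀ {n} (G : Graph n) → 3 ℕ.≤ n → ∀ {c₀ c₁} → c₀ ≢ c₁ →
                                  IsUniversal G c₀ → IsUniversal G c₁ → IsFracEdgeDim G (half n)
two-universals⇒fracEdgeDim-half {n} G 3≤n {c₀} {c₁} c₀≢c₁ u₀ u₁ = fracEdgeDim-½ G minimal
  where
  other : ∀ u → ∃ λ v → u ≢ v
  other u with u ≟ c₀
  ... | yes refl = c₁ , c₀≢c₁
  ... | no u≢c₀  = c₀ , u≢c₀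
  minimal : ∀ g → IsEdgeResolvingFunction G g → half n ≤ total g
  minimal g resolving = subst (half n ≤_) (sym (total≡sum g))
    (Pairing.half≤sum g (proj₁ ∘ proj₁ resolving) _≢_ (weight-two-universals G resolving 3≤n c₀≢c₁ u₀ u₁)
      (λ _ _ u≢v → u≢v) other)

module _ {m} (H : Graph m) where

  private
    apexAdj : Fin (2 ℕ.+ m) → Fin (2 ℕ.+ m) → Bool
    apexAdj (suc (suc x)) (suc (suc y)) = adj H x y
    apexAdj u             v             = not (does (u ≟ v))

    apexAdj-sym : ∀ u v → apexAdj u v ≡ apexAdj v u
    apexAdj-sym (suc (suc x)) (suc (suc y)) = Graph.sym H x y
    apexAdj-sym zero          zero          = refl
    apexAdj-sym zero          (suc zero)    = refl
    apexAdj-sym zero          (suc (suc _)) = refl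
    apexAdj-sym (suc zero)    zero          = refl
    apexAdj-sym (suc zero)    (suc zero)    = refl
    apexAdj-sym (suc zero)    (suc (suc _)) = refl
    apexAdj-sym (suc (suc _)) zero          = refl
    apexAdj-sym (suc (suc _)) (suc zero)    = refl

    apexAdj-irrefl : ∀ u → apexAdj u u ≡ false
    apexAdj-irrefl zero          = refl
    apexAdj-irrefl (suc zero)    = refl
    apexAdj-irrefl (suc (suc x)) = irrefl H x

  -- H joined with an edge: the apexes 0 and 1 are adjacent to every other vertex.
  twoApex : Graph (2 ℕ.+ m)
  twoApex = record { adj = apexAdj ; sym = apexAdj-sym ; irrefl = apexAdj-irrefl }

  apex₀-universal : IsUniversal twoApex zero
  apex₀-universal zero          0≢0 = contradiction refl 0≢0
  apex₀-universal (suc _)       _   = refl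

  apex₁-universal : IsUniversal twoApex (suc zero)
  apex₁-universal zero          _   = refl
  apex₁-universal (suc zero)    1≢1 = contradiction refl 1≢1
  apex₁-universal (suc (suc _)) _   = refl

  inner : Fin m → Fin (2 ℕ.+ m)
  inner x = suc (suc x)

  dist-apex-inner : ∀ {a} → a ≡ zero ⊎ a ≡ suc zero → ∀ x → dist twoApex a (inner x) ≡ 1
  dist-apex-inner (inj₁ refl) x = adj⇒dist≡1 twoApex {zero} {inner x} refl
  dist-apex-inner (inj₂ refl) x = adj⇒dist≡1 twoApex {suc zero} {inner x} refl

  dist-inner : ∀ {x y} → x ≢ y → dist twoApex (inner x) (inner y) ≡ (if adj H x y then 1 else 2)
  dist-inner {x} {y} x≢y with adj H x y in xy
  ... | true  = adj⇒dist≡1 twoApex {inner x} {inner y} xy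
  ... | false = dist-universal twoApex apex₀-universal {inner x} {inner y} (x≢y ∘ suc-injective ∘ suc-injective) xy

rook : ∀ k → Graph (k ℕ.* k)
rook k = record { adj = rookAdj ; sym = rookAdj-sym ; irrefl = rookAdj-irrefl }
  where
  row col : Fin (k ℕ.* k) → Fin k
  row = quotient {k} k
  col = remainder {k} k
  rookAdj : Fin (k ℕ.* k) → Fin (k ℕ.* k) → Bool
  rookAdj x y = does (row x ≟ row y) xor does (col x ≟ col y)
  rookAdj-sym : ∀ x y → rookAdj x y ≡ rookAdj y x
  rookAdj-sym x y = cong₂ _xor_ (does-comm _≟_ (row x) (row y)) (does-comm _≟_ (col x) (col y))
  rookAdj-irrefl : ∀ x → rookAdj x x ≡ false
  rookAdj-irrefl x rewrite dec-true (row x ≟ row x) refl | dec-true (col x ≟ col x) refl = refl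

rook-adj : ∀ {k} (i j a b : Fin k) → adj (rook k) (combine i j) (combine a b) ≡ (does (i ≟ a) xor does (j ≟ b))
rook-adj {k} i j a b = cong₂ _xor_ (cong₂ (λ x y → does (x ≟ y)) (row i j) (row a b))
                                   (cong₂ (λ x y → does (x ≟ y)) (col i j) (col a b))
  where
  row : ∀ i j → quotient {k} k (combine i j) ≡ i
  row i j = cong proj₁ (remQuot-combine i j)
  col : ∀ i j → remainder {k} k (combine i j) ≡ j
  col i j = cong proj₂ (remQuot-combine i j)

-- t stays a variable, so k = t * 2 does not reduce: with a numeral, dist on G would unfold into
-- huge normal forms.
module RookFamily (t : ℕ) (2≤t : 2 ℕ.≤ t) where

  k N : ℕ
  k = t ℕ.* 2
  N = 2 ℕ.+ k ℕ.* k

  G : Graph N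
  G = twoApex (rook k)

  3≤k : 3 ℕ.≤ k
  3≤k = ℕ.≤-trans (ℕ.n≤1+n 3) (ℕ.*-monoˡ-≤ 2 2≤t)

  3≤N : 3 ℕ.≤ N
  3≤N = s≤s (s≤s (ℕ.*-mono-≤ {1} {k} {1} {k} (ℕ.≤-trans (s≤s z≤n) 3≤k) (ℕ.≤-trans (s≤s z≤n) 3≤k)))

  cell : Fin k → Fin k → Fin N
  cell a b = inner (rook k) (combine a b)

  data Vertex : Fin N → Set where
    apex₀ : Vertex zero
    apex₁ : Vertex (suc zero)
    at    : ∀ a b → Vertex (cell a b)

  vertex : ∀ v → Vertex v
  vertex zero          = apex₀
  vertex (suc zero)    = apex₁
  vertex (suc (suc h)) = subst Vertex (cong (inner (rook k)) (combine-remQuot {k} k h)) (at _ _)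

  differ : Fin k → Fin k → ℕ
  differ a b = if does (a ≟ b) then 0 else 1

  differ-self : ∀ a → differ a a ≡ 0
  differ-self a rewrite dec-true (a ≟ a) refl = refl

  differ-≢ : ∀ {a b} → a ≢ b → differ a b ≡ 1
  differ-≢ {a} {b} a≢b rewrite dec-false (a ≟ b) a≢b = refl

  dist-distinct-cells : ∀ {i j a b} → (i , j) ≢ (a , b) →
                        dist G (cell i j) (cell a b) ≡ (if does (i ≟ a) xor does (j ≟ b) then 1 else 2)
  dist-distinct-cells {i} {j} {a} {b} ≢ =
    trans (dist-inner (rook k) (≢ ∘ λ eq → let i≡a , j≡b = combine-injective i j a b eq in cong₂ _,_ i≡a j≡b))
          (cong (if_then 1 else 2) (rook-adj i j a b))

  dist-cells : ∀ i j a b → dist G (cell i j) (cell a b) ≡ differ i a ℕ.+ differ j b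
  dist-cells i j a b with i ≟ a | j ≟ b | dist-distinct-cells {i} {j} {a} {b}
  ... | yes refl | yes refl | _ = dist-self G (cell i j)
  ... | yes refl | no j≢b | d = d (j≢b ∘ cong proj₂)
  ... | no i≢a   | yes _  | d = d (i≢a ∘ cong proj₁)
  ... | no i≢a   | no _   | d = d (i≢a ∘ cong proj₁)

  dist-cells′ : ∀ i j a b {r c} → differ i a ≡ r → differ j b ≡ c → dist G (cell i j) (cell a b) ≡ r ℕ.+ c
  dist-cells′ i j a b refl refl = dist-cells i j a b

  separated-by : ∀ x y z {d d′} → dist G x z ≡ d → dist G y z ≡ d′ → d ≢ d′ → inRv G x y z ≡ true
  separated-by x y z dx dy d≢d′ = inRv-≢ G x y z λ eq → d≢d′ (trans (sym dx) (trans eq dy))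

  sum-vertices : ∀ F → sum F ≡ F zero + (F (suc zero) + ∑[ a < k ] ∑[ b < k ] F (cell a b))
  sum-vertices F = cong (λ s → F zero + (F (suc zero) + s)) (sum-combine k (F ∘ inner (rook k)))

  d : ℕ
  d = ℕ.pred (k ℕ.* 2)

  1+d≡2k : suc d ≡ k ℕ.* 2
  1+d≡2k = ℕ.suc-pred (k ℕ.* 2) {{ℕ.>-nonZero (ℕ.≤-trans (s≤s z≤n) (ℕ.≤-trans 3≤k (ℕ.m≤m*n k 2)))}}

  -- 1/(2k), written with suc d = 2k
  q : ℚ
  q = 1 /ₙ suc d

  k·q≡½ : ∑[ _ < k ] q ≡ ½
  k·q≡½ = trans (sum-const k 1 d) (/ₙ-cong {k ℕ.* 1} {1} d 1 (begin
      k ℕ.* 1 ℕ.* 2    ≡⟨ cong (ℕ._* 2) (ℕ.*-identityʳ k) ⟩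
      k ℕ.* 2          ≡⟨ 1+d≡2k ⟨
      suc d            ≡⟨ ℕ.*-identityˡ (suc d) ⟨
      1 ℕ.* suc d      ∎))
    where open ≡-Reasoning

  g : Fin N → ℚ
  g zero          = ½
  g (suc zero)    = ½
  g (suc (suc _)) = q

  q-unit : (0ℚ ≤ q) × (q ≤ 1ℚ)
  q-unit = /ₙ-nonNeg 1 d , ℚ.≤-trans (≤-sum {F = λ (_ : Fin k) → q} (λ _ → /ₙ-nonNeg 1 d) (Data.Fin.fromℕ< (ℕ.≤-trans (s≤s z≤n) 3≤k)))
                                     (ℚ.≤-trans (ℚ.≤-reflexive k·q≡½) (ℚ.≤ᵇ⇒≤ _))

  g-unit : Unit g
  g-unit zero          = ℚ.≤ᵇ⇒≤ _ , ℚ.≤ᵇ⇒≤ _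
  g-unit (suc zero)    = ℚ.≤ᵇ⇒≤ _ , ℚ.≤ᵇ⇒≤ _
  g-unit (suc (suc _)) = q-unit

  g≥0 : Nonneg g
  g≥0 = proj₁ ∘ g-unit

  module _ (F : Fin k → Fin k → ℚ) (F≥0 : ∀ a b → 0ℚ ≤ F a b) where

    ½≤-one-per-row : (∀ a → ∃ λ b → q ≤ F a b) → ½ ≤ ∑[ a < k ] ∑[ b < k ] F a b
    ½≤-one-per-row one = begin
        ½                          ≡⟨ k·q≡½ ⟨
        ∑[ _ < k ] q               ≤⟨ sum-mono-≤ (λ a → ℚ.≤-trans (proj₂ (one a)) (≤-sum (F≥0 a) (proj₁ (one a)))) ⟩
        ∑[ a < k ] ∑[ b < k ] F a b ∎
      where open ℚ.≤-Reasoning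

    1≤-two-per-row : (∀ a → ∃₂ λ b b′ → b ≢ b′ × q ≤ F a b × q ≤ F a b′) → 1ℚ ≤ ∑[ a < k ] ∑[ b < k ] F a b
    1≤-two-per-row two = begin
        1ℚ                            ≡⟨ cong₂ _+_ k·q≡½ k·q≡½ ⟨
        ∑[ _ < k ] q + ∑[ _ < k ] q   ≡⟨ ∑-distrib-+ {k} (λ _ → q) (λ _ → q) ⟨
        ∑[ _ < k ] (q + q)            ≤⟨ sum-mono-≤ row ⟩
        ∑[ a < k ] ∑[ b < k ] F a b   ∎
      where
      open ℚ.≤-Reasoning
      row : ∀ a → q + q ≤ ∑[ b < k ] F a b
      row a with two a
      ... | b , b′ , b≢b′ , qb , qb′ = ℚ.≤-trans (ℚ.+-mono-≤ qb qb′) (pair-≤-sum (F≥0 a) b≢b′)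

  1≤-two-per-column : (F : Fin k → Fin k → ℚ) → (∀ a b → 0ℚ ≤ F a b) →
                      (∀ b → ∃₂ λ a a′ → a ≢ a′ × q ≤ F a b × q ≤ F a′ b) → 1ℚ ≤ ∑[ a < k ] ∑[ b < k ] F a b
  1≤-two-per-column F F≥0 two =
    ℚ.≤-trans (1≤-two-per-row (λ b a → F a b) (λ b a → F≥0 a b) two) (ℚ.≤-reflexive (∑-comm (λ b a → F a b)))

  module _ (P : Fin N → Bool) where

    cells : Fin k → Fin k → ℚ
    cells a b = restrict P g (cell a b)

    cells≥0 : ∀ a b → 0ℚ ≤ cells a b
    cells≥0 a b = restrict-nonNeg P g≥0 (cell a b)

    q≤cell : ∀ {a b} → P (cell a b) ≡ true → q ≤ cells a b
    q≤cell Pab = ℚ.≤-reflexive (sym (restrict-member P g Pab))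

    sumOver-≥ : ∀ {r₀ r₁ s} → r₀ ≤ restrict P g zero → r₁ ≤ restrict P g (suc zero) →
                s ≤ ∑[ a < k ] ∑[ b < k ] cells a b → r₀ + (r₁ + s) ≤ sumOver P g
    sumOver-≥ r₀≤ r₁≤ s≤ = ℚ.≤-trans (ℚ.+-mono-≤ r₀≤ (ℚ.+-mono-≤ r₁≤ s≤))
      (ℚ.≤-reflexive (sym (trans (sumOver≡sum P g) (sum-vertices (restrict P g)))))

    1≤sumOver-cells : 1ℚ ≤ ∑[ a < k ] ∑[ b < k ] cells a b → 1ℚ ≤ sumOver P g
    1≤sumOver-cells 1≤ = sumOver-≥ (restrict-nonNeg P g≥0 zero) (restrict-nonNeg P g≥0 (suc zero)) 1≤

  apex≢cell : ∀ {v} → v ≡ zero ⊎ v ≡ suc zero → ∀ {a b} → v ≢ cell a b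
  apex≢cell (inj₁ refl) ()
  apex≢cell (inj₂ refl) ()

  apex-cell-rows : ∀ {v} → v ≡ zero ⊎ v ≡ suc zero → ∀ i j a → ∃ λ b → q ≤ cells (inRv G v (cell i j)) a b
  apex-cell-rows {v} v-apex i j a with a ≟ i | third-vertex 3≤k j j
  ... | yes refl | _ = j , q≤cell P (inRv-right G {v} {cell i j} (apex≢cell v-apex))
    where P = inRv G v (cell i j)
  ... | no a≢i | b , b≢j , _ = b , q≤cell P (separated-by v (cell i j) (cell a b)
                                            (dist-apex-inner (rook k) v-apex (combine a b))
                                            (dist-cells′ i j a b (differ-≢ (a≢i ∘ sym)) (differ-≢ (b≢j ∘ sym))) λ ())
    where P = inRv G v (cell i j)

  apex-resolves-cell : ∀ {v} → v ≡ zero ⊎ v ≡ suc zero → ∀ i j → 1ℚ ≤ sumOver (inRv G v (cell i j)) g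
  apex-resolves-cell (inj₁ refl) i j =
    sumOver-≥ P (ℚ.≤-reflexive (sym (restrict-member P g {zero} (inRv-left G {zero} {cell i j} λ ()))))
      (restrict-nonNeg P g≥0 (suc zero))
      (½≤-one-per-row (cells P) (cells≥0 P) (apex-cell-rows (inj₁ refl) i j))
    where P = inRv G zero (cell i j)
  apex-resolves-cell (inj₂ refl) i j =
    sumOver-≥ P (restrict-nonNeg P g≥0 zero)
      (ℚ.≤-reflexive (sym (restrict-member P g {suc zero} (inRv-left G {suc zero} {cell i j} λ ()))))
      (½≤-one-per-row (cells P) (cells≥0 P) (apex-cell-rows (inj₂ refl) i j))
    where P = inRv G (suc zero) (cell i j)

  module _ {i j i′ j′} (x≢y : cell i j ≢ cell i′ j′) where

    private
      P = inRv G (cell i j) (cell i′ j′)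

    on-x : q ≤ cells P i j
    on-x = q≤cell P (inRv-left G x≢y)

    on-y : q ≤ cells P i′ j′
    on-y = q≤cell P (inRv-right G x≢y)

    member : ∀ a b {r c r′ c′} → differ i a ≡ r → differ j b ≡ c → differ i′ a ≡ r′ → differ j′ b ≡ c′ →
             r ℕ.+ c ≢ r′ ℕ.+ c′ → q ≤ cells P a b
    member a b ia jb i′a j′b ≢ =
      q≤cell P (separated-by (cell i j) (cell i′ j′) (cell a b) (dist-cells′ i j a b ia jb) (dist-cells′ i′ j′ a b i′a j′b) ≢)

    two-in-row : j ≢ j′ → ∀ a → ∃₂ λ b b′ → b ≢ b′ × q ≤ cells P a b × q ≤ cells P a b′
    two-in-row j≢j′ a with i ≟ a | i′ ≟ a | third-vertex 3≤k j j′
    ... | yes refl | yes refl | _ = j , j′ , j≢j′ , on-x , on-y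
    ... | yes refl | no i′≢a | b , b≢j , b≢j′ = j , b , b≢j ∘ sym , on-x ,
      member a b (differ-self a) (differ-≢ (b≢j ∘ sym)) (differ-≢ i′≢a) (differ-≢ (b≢j′ ∘ sym)) λ ()
    ... | no i≢a | yes refl | b , b≢j , b≢j′ = j′ , b , b≢j′ ∘ sym , on-y ,
      member a b (differ-≢ i≢a) (differ-≢ (b≢j ∘ sym)) (differ-self a) (differ-≢ (b≢j′ ∘ sym)) λ ()
    ... | no i≢a | no i′≢a | _ = j , j′ , j≢j′ ,
      member a j (differ-≢ i≢a) (differ-self j) (differ-≢ i′≢a) (differ-≢ (j≢j′ ∘ sym)) (λ ()) ,
      member a j′ (differ-≢ i≢a) (differ-≢ j≢j′) (differ-≢ i′≢a) (differ-self j′) λ ()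

    same-column⇒rows-≢ : j ≡ j′ → i ≢ i′
    same-column⇒rows-≢ j≡j′ refl = x≢y (cong (cell i) j≡j′)

    two-in-column : j ≡ j′ → ∀ b → ∃₂ λ a a′ → a ≢ a′ × q ≤ cells P a b × q ≤ cells P a′ b
    two-in-column j≡j′ b with j ≟ b | same-column⇒rows-≢ j≡j′
    ... | yes refl | i≢i′ = i , i′ , i≢i′ , on-x , subst (λ c → q ≤ cells P i′ c) (sym j≡j′) on-y
    ... | no j≢b   | i≢i′ = i , i′ , i≢i′ ,
      member i b (differ-self i) (differ-≢ j≢b) (differ-≢ (i≢i′ ∘ sym)) (differ-≢ j′≢b) (λ ()) ,
      member i′ b (differ-≢ i≢i′) (differ-≢ j≢b) (differ-self i′) (differ-≢ j′≢b) λ ()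
      where
      j′≢b : j′ ≢ b
      j′≢b = j≢b ∘ trans j≡j′

  -- Two cells in different columns are told apart by two cells of every row,
  -- two cells in the same column by two cells of every column.
  cells-resolve : ∀ {i j i′ j′} → cell i j ≢ cell i′ j′ → 1ℚ ≤ sumOver (inRv G (cell i j) (cell i′ j′)) g
  cells-resolve {i} {j} {i′} {j′} x≢y with j ≟ j′
  ... | no j≢j′  = 1≤sumOver-cells P (1≤-two-per-row (cells P) (cells≥0 P) (two-in-row x≢y j≢j′))
    where P = inRv G (cell i j) (cell i′ j′)
  ... | yes j≡j′ = 1≤sumOver-cells P (1≤-two-per-column (cells P) (cells≥0 P) (two-in-column x≢y j≡j′))
    where P = inRv G (cell i j) (cell i′ j′)

  g-resolving : IsResolvingFunction G g
  g-resolving = g-unit , λ x y x≢y → by-vertex (vertex x) (vertex y) x≢y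
    where
    swap : ∀ {x y} → 1ℚ ≤ sumOver (inRv G y x) g → 1ℚ ≤ sumOver (inRv G x y) g
    swap {x} {y} = subst (1ℚ ≤_) (sumOver-cong (inRv-comm G y x) g)
    by-vertex : ∀ {x y} → Vertex x → Vertex y → x ≢ y → 1ℚ ≤ sumOver (inRv G x y) g
    by-vertex apex₀ apex₀ 0≢0 = contradiction refl 0≢0
    by-vertex apex₁ apex₁ 1≢1 = contradiction refl 1≢1
    by-vertex apex₀ apex₁ 0≢1 = sumOver-≥-pair (inRv G zero (suc zero)) g≥0 0≢1 (inRv-left G 0≢1) (inRv-right G 0≢1)
    by-vertex apex₁ apex₀ 1≢0 = sumOver-≥-pair (inRv G (suc zero) zero) g≥0 1≢0 (inRv-left G 1≢0) (inRv-right G 1≢0)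
    by-vertex apex₀ (at i j) _ = apex-resolves-cell (inj₁ refl) i j
    by-vertex apex₁ (at i j) _ = apex-resolves-cell (inj₂ refl) i j
    by-vertex (at i j) apex₀ _ = swap {cell i j} {zero} (apex-resolves-cell (inj₁ refl) i j)
    by-vertex (at i j) apex₁ _ = swap {cell i j} {suc zero} (apex-resolves-cell (inj₂ refl) i j)
    by-vertex (at i j) (at a b) x≢y = cells-resolve x≢y

  total-g : total g ≡ half (2 ℕ.+ k)
  total-g = begin
      total g                                      ≡⟨ total≡sum g ⟩
      sum g                                        ≡⟨ sum-vertices g ⟩
      ½ + (½ + ∑[ a < k ] ∑[ b < k ] q)            ≡⟨ cong (λ s → ½ + (½ + s)) (trans (sum-cong-≗ {k} (λ _ → k·q≡½)) (sum-½ k)) ⟩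
      ½ + (½ + half k)                             ≡⟨ cong (½ +_) (/ₙ-+ 1 k 1) ⟩
      ½ + half (1 ℕ.+ k)                           ≡⟨ /ₙ-+ 1 (1 ℕ.+ k) 1 ⟩
      half (2 ℕ.+ k)                               ∎
    where open ≡-Reasoning

  dist-cell-apex : ∀ {v} → v ≡ zero ⊎ v ≡ suc zero → ∀ a b → dist G (cell a b) v ≡ 1
  dist-cell-apex {v} v-apex a b = trans (dist-comm G (cell a b) v) (dist-apex-inner (rook k) v-apex (combine a b))

  row₀ : Fin k
  row₀ = Data.Fin.fromℕ< (ℕ.≤-trans (s≤s z≤n) 3≤k)

  -- The apex pair and the cell pairs (row₀, 2s), (row₀, 2s + 1): their resolving sets are disjoint.
  S : Fin t → Fin N → Bool
  S s = inRv G (cell row₀ (combine s zero)) (cell row₀ (combine s (suc zero)))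

  S₀ : Fin N → Bool
  S₀ = inRv G zero (suc zero)

  S-apex : ∀ s {v} → v ≡ zero ⊎ v ≡ suc zero → S s v ≡ false
  S-apex s {v} v-apex = inRv-≡ G (cell row₀ c₀) (cell row₀ c₁) v
    (trans (dist-cell-apex v-apex row₀ c₀) (sym (dist-cell-apex v-apex row₀ c₁)))
    where
    c₀ = combine s zero
    c₁ = combine s (suc zero)

  S₀-cell : ∀ a b → S₀ (cell a b) ≡ false
  S₀-cell a b = inRv-≡ G zero (suc zero) (cell a b)
    (trans (dist-apex-inner (rook k) (inj₁ refl) (combine a b)) (sym (dist-apex-inner (rook k) (inj₂ refl) (combine a b))))

  S-cell : ∀ s a b → s ≢ quotient {t} 2 b → S s (cell a b) ≡ false
  S-cell s a b s≢ = inRv-≡ G (cell row₀ c₀) (cell row₀ c₁) (cell a b)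
    (trans (dist-cells′ row₀ c₀ a b refl (differ-≢ (other zero))) (sym (dist-cells′ row₀ c₁ a b refl (differ-≢ (other (suc zero))))))
    where
    c₀ = combine s zero
    c₁ = combine s (suc zero)
    other : ∀ e → combine s e ≢ b
    other e refl = s≢ (sym (cong proj₁ (remQuot-combine s e)))

  module _ (g′ : Fin N → ℚ) (g′≥0 : Nonneg g′) where

    disjoint-at : ∀ z → restrict S₀ g′ z + ∑[ s < t ] restrict (S s) g′ z ≤ g′ z
    disjoint-at z = by-vertex (vertex z)
      where
      at-apex : ∀ {v} → v ≡ zero ⊎ v ≡ suc zero → restrict S₀ g′ v + ∑[ s < t ] restrict (S s) g′ v ≤ g′ v
      at-apex {v} v-apex = begin
          restrict S₀ g′ v + ∑[ s < t ] restrict (S s) g′ v  ≡⟨ cong (restrict S₀ g′ v +_)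
                                                                  (sum-zero {t} (λ s → restrict-nonmember (S s) g′ {v} (S-apex s v-apex))) ⟩
          restrict S₀ g′ v + 0ℚ                              ≡⟨ ℚ.+-identityʳ _ ⟩
          restrict S₀ g′ v                                   ≤⟨ restrict-≤ S₀ g′≥0 v ⟩
          g′ v                                               ∎
        where open ℚ.≤-Reasoning
      by-vertex : ∀ {z} → Vertex z → restrict S₀ g′ z + ∑[ s < t ] restrict (S s) g′ z ≤ g′ z
      by-vertex apex₀ = at-apex (inj₁ refl)
      by-vertex apex₁ = at-apex (inj₂ refl)
      by-vertex (at a b) = begin
          restrict S₀ g′ (cell a b) + ∑[ s < t ] restrict (S s) g′ (cell a b)
            ≡⟨ cong₂ _+_ (restrict-nonmember S₀ g′ {cell a b} (S₀-cell a b))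
                         (sum-point (λ s → restrict (S s) g′ (cell a b)) (quotient {t} 2 b) (λ s s≢ → restrict-nonmember (S s) g′ {cell a b} (S-cell s a b s≢))) ⟩
          0ℚ + restrict (S (quotient {t} 2 b)) g′ (cell a b)   ≡⟨ ℚ.+-identityˡ _ ⟩
          restrict (S (quotient {t} 2 b)) g′ (cell a b)        ≤⟨ restrict-≤ (S (quotient {t} 2 b)) g′≥0 (cell a b) ⟩
          g′ (cell a b)                                        ∎
        where open ℚ.≤-Reasoning

  half-2+k≤ : ∀ g′ → IsResolvingFunction G g′ → half (2 ℕ.+ k) ≤ total g′
  half-2+k≤ g′ (unit , resolves) = begin
      half (2 ℕ.+ k)                                               ≡⟨ /ₙ-+ 2 k 1 ⟨
      1ℚ + half k                                                  ≡⟨ cong (1ℚ +_) (sum-const t 2 1) ⟨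
      1ℚ + ∑[ _ < t ] 1ℚ                                           ≤⟨ ℚ.+-mono-≤ (resolves zero (suc zero) λ ())
                                                                        (sum-mono-≤ {t} λ s → resolves (cell row₀ (combine s zero)) (cell row₀ (combine s (suc zero))) (pair≢ s)) ⟩
      sumOver S₀ g′ + ∑[ s < t ] sumOver (S s) g′                  ≡⟨ cong₂ _+_ (sumOver≡sum S₀ g′)
                                                                        (trans (sum-cong-≗ {t} λ s → sumOver≡sum (S s) g′)
                                                                               (∑-comm {t} {N} (λ s z → restrict (S s) g′ z))) ⟩
      sum (restrict S₀ g′) + ∑[ z < N ] ∑[ s < t ] restrict (S s) g′ z ≡⟨ ∑-distrib-+ {N} (restrict S₀ g′) (λ z → ∑[ s < t ] restrict (S s) g′ z) ⟨
      ∑[ z < N ] (restrict S₀ g′ z + ∑[ s < t ] restrict (S s) g′ z) ≤⟨ sum-mono-≤ (disjoint-at g′ (proj₁ ∘ unit)) ⟩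
      sum g′                                                       ≡⟨ total≡sum g′ ⟨
      total g′                                                     ∎
    where
    open ℚ.≤-Reasoning
    pair≢ : ∀ s → cell row₀ (combine s zero) ≢ cell row₀ (combine s (suc zero))
    pair≢ s eq with combine-injectiveʳ s zero s (suc zero)
                      (combine-injectiveʳ row₀ _ row₀ _ (suc-injective (suc-injective eq)))
    ... | ()

  connected : Connected G
  connected = universal⇒connected G (apex₀-universal (rook k))

  fracDim : IsFracDim G (half (2 ℕ.+ k))
  fracDim = (g , g-resolving , total-g) , half-2+k≤

  fracEdgeDim : IsFracEdgeDim G (half N)
  fracEdgeDim = two-universals⇒fracEdgeDim-half G 3≤N (λ ()) (apex₀-universal (rook k)) (apex₁-universal (rook k))

  dim<edim : half (2 ℕ.+ k) < half N
  dim<edim = /ₙ-mono-< 1 (ℕ.+-monoʳ-< 2 (ℕ.m<m*n k k {{ℕ.>-nonZero 0<k}} (ℕ.<-≤-trans (s≤s (s≤s z≤n)) 3≤k)))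
    where 0<k = ℕ.<-≤-trans (s≤s z≤n) 3≤k

  0<dim : 0ℚ < half (2 ℕ.+ k)
  0<dim = /ₙ-pos (1 ℕ.+ k) 1

  M·dim<edim : ∀ {M} m → M ≤ m /ₙ 1 → m ℕ.* (2 ℕ.+ k) ℕ.< 2 ℕ.+ k ℕ.* k → M * half (2 ℕ.+ k) < half N
  M·dim<edim {M} m M≤m m·dim<edim = begin-strict
      M * half (2 ℕ.+ k)              ≤⟨ ℚ.*-monoʳ-≤-nonNeg (half (2 ℕ.+ k)) {{ℚ.normalize-nonNeg (2 ℕ.+ k) 2}} M≤m ⟩
      (m /ₙ 1) * half (2 ℕ.+ k)       ≡⟨ /ₙ-* m (2 ℕ.+ k) 1 ⟩
      half (m ℕ.* (2 ℕ.+ k))          <⟨ /ₙ-mono-< 1 m·dim<edim ⟩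
      half N                          ∎
    where open ℚ.≤-Reasoning

dim<edim-margin : ∀ m → let k = (m ℕ.+ 2) ℕ.* 2 in m ℕ.* (2 ℕ.+ k) ℕ.< 2 ℕ.+ k ℕ.* k
dim<edim-margin m = subst (suc (m ℕ.* (2 ℕ.+ (m ℕ.+ 2) ℕ.* 2)) ℕ.≤_) (sym expand) (ℕ.m≤m+n _ _)
  where
  open +-*-Solver
  expand : 2 ℕ.+ (m ℕ.+ 2) ℕ.* 2 ℕ.* ((m ℕ.+ 2) ℕ.* 2)
         ≡ suc (m ℕ.* (2 ℕ.+ (m ℕ.+ 2) ℕ.* 2)) ℕ.+ (2 ℕ.* m ℕ.* m ℕ.+ 10 ℕ.* m ℕ.+ 17)
  expand = solve 1 (λ m → con 2 :+ (m :+ con 2) :* con 2 :* ((m :+ con 2) :* con 2)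
                        := con 1 :+ m :* (con 2 :+ (m :+ con 2) :* con 2) :+ (con 2 :* m :* m :+ con 10 :* m :+ con 17))
                   refl m

unbounded-ratio : ∀ (M : ℚ) → Σ ℕ λ n → 3 ℕ.≤ n × Σ (Graph n) λ G → Connected G × Σ ℚ λ r →
                  IsFracDim G r × IsFracEdgeDim G (half n) × r < half n × 0ℚ < r × M * r < half n
unbounded-ratio M = let m , M≤m = ≤-/ₙ1 M ; open RookFamily (m ℕ.+ 2) (ℕ.m≤n+m 2 m) in
  N , 3≤N , G , connected , half (2 ℕ.+ k) , fracDim , fracEdgeDim , dim<edim , 0<dim , M·dim<edim m M≤m (dim<edim-margin m)

mainTheorem9 :
    -- (a)
    (∀ (n : ℕ) → 3 ℕ.≤ n → (G : Graph n) → Connected G →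
       IsFracDim G (half n) → IsFracEdgeDim G (half n))
    ×
    -- (b) a single example
    (Σ ℕ λ n → 3 ℕ.≤ n × Σ (Graph n) λ G → Connected G × Σ ℚ λ r →
       IsFracDim G r × IsFracEdgeDim G (half n) × r < half n)
    ×
    -- (b) moreover: ratio edim_f / dim_f unbounded (M * dim_f < edim_f, dim_f > 0)
    (∀ (M : ℚ) → Σ ℕ λ n → 3 ℕ.≤ n × Σ (Graph n) λ G → Connected G × Σ ℚ λ r →
       IsFracDim G r × IsFracEdgeDim G (half n) × r < half n ×
       0ℚ < r × M * r < half n)
mainTheorem9 =
  (λ n 3≤n → fracDim-half⇒fracEdgeDim-half 3≤n) ,
  (case unbounded-ratio 0ℚ of λ { (n , 3≤n , G , connected , r , fracDim , fracEdgeDim , dim<edim , _) →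
     n , 3≤n , G , connected , r , fracDim , fracEdgeDim , dim<edim }) ,
  unbounded-ratio
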